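{- Let $n, i_1, j_1,\ldots,i_n,j_n$ be positive integers and $N:=i_1+j_1+\cdots+i_n+j_n$. Then $$\Omega'(i_1,j_1,\ldots,i_n,j_n)=\frac{1}{N+1}\sum_{k=1}^{n}\Omega'(i_1,j_1,\ldots,i_{k-1},j_{k-1},\,i_k-1)\;\Omega'(j_k-1,\,i_{k+1},j_{k+1},\ldots,i_n,j_n),$$ and $$\Omega'(i_1,j_1,\ldots,i_n,j_n)=\frac{1}{N+1}\sum_{k=0}^{n}\Omega'(i_1,j_1,\ldots,i_k,\,j_k-1)\;\Omega'(i_{k+1}-1,\,j_{k+1},\ldots,i_n,j_n),$$ where in the second formula, for $k=0$ the first factor has the empty argument list (so equals $\Omega'()=1$), and for $k=n$ the second factor has the empty argument list (so equals $1$).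
   Context: A permutation $\tau$ of $\{0,\ldots,M\}$ is said to increase (resp. decrease) on a set $\{p,\ldots,q\}\subseteq\{0,\ldots,M\}$ if $\tau(j)<\tau(j+1)$ (resp. $\tau(j)>\tau(j+1)$) for every $j=p,\ldots,q-1$ (vacuous when $p=q$). For a finite sequence $a_1,\ldots,a_m$ of nonnegative integers ($m\ge1$), put $M:=a_1+\cdots+a_m$, $t_0:=0$, $t_k:=a_1+\cdots+a_k$. Then $\Omega(a_1,\ldots,a_m)$ denotes the number of permutations of $\{0,\ldots,M\}$ which, for every $k=1,\ldots,m$, increase on $\{t_{k-1},\ldots,t_k\}$ if $k$ is odd and decrease on $\{t_{k-1},\ldots,t_k\}$ if $k$ is even (arguments alternately prescribe increasing and decreasing run lengths, starting with increasing). By convention $\Omega$ with no arguments equals $1$. Further, $\Omega'(a_1,\ldots,a_m):=\Omega(a_1,\ldots,a_m)/(a_1+\cdots+a_m+1)!$, and $\Omega'()=1$. -}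

module Defs where

open import Data.Bool using (Bool; true; false; _∧_; not; if_then_else_)
open import Data.Nat using (ℕ; zero; suc; _+_; _∸_; _<ᵇ_; _≡ᵇ_; _!)
open import Data.Nat.Properties using (_!≢0)
open import Data.List using (List; []; _∷_; _++_; length; take; drop; filterᵇ; concatMap; map; foldr; upTo)
open import Data.Nat.ListAction using (sum)
open import Data.Bool.ListAction using (any)
open import Data.Product using (_×_; _,_)
open import Data.Integer using (+_)
open import Data.Rational using (ℚ; _/_) renaming (_+_ to _+ℚ_; _*_ to _*ℚ_)
open import Data.Rational using () renaming (0ℚ to 0q)

allLists : ℕ → ℕ → List (List ℕ)
allLists zero    m = [] ∷ []
allLists (suc k) m = concatMap (λ x → map (x ∷_) (allLists k m)) (upTo m)

elem : ℕ → List ℕ → Bool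
elem x ys = any (λ y → x ≡ᵇ y) ys

distinct : List ℕ → Bool
distinct []       = true
distinct (x ∷ xs) = not (elem x xs) ∧ distinct xs

-- Permutations τ of {0,...,M}, encoded as the list [τ(0), ..., τ(M)]:
-- lists of length M+1 with entries in {0..M}, pairwise distinct.
perms : ℕ → List (List ℕ)
perms M = filterᵇ distinct (allLists (suc M) (suc M))

increasing : List ℕ → Bool
increasing []           = true
increasing (x ∷ [])     = true
increasing (x ∷ y ∷ ys) = (x <ᵇ y) ∧ increasing (y ∷ ys)

decreasing : List ℕ → Bool
decreasing []           = true
decreasing (x ∷ [])     = true
decreasing (x ∷ y ∷ ys) = (y <ᵇ x) ∧ decreasing (y ∷ ys)

-- fits up (a₁ ∷ as) τ : τ increases (if up, else decreases) on positions
-- {0,...,a₁} (the first a₁+1 entries), and the remainder, starting at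
-- position a₁ (shared endpoint), fits the remaining runs with the opposite
-- direction.
fits : Bool → List ℕ → List ℕ → Bool
fits up []       τ = true
fits up (a ∷ as) τ =
  (if up then increasing (take (suc a) τ) else decreasing (take (suc a) τ))
  ∧ fits (not up) as (drop a τ)

-- Ω(a₁,...,aₘ) : number of permutations of {0,...,M}, M = a₁+...+aₘ,
-- with the prescribed alternating runs (starting increasing). Ω() = 1.
Ω : List ℕ → ℕ
Ω as = length (filterᵇ (fits true as) (perms (sum as)))

Ω' : List ℕ → ℚ
Ω' as = _/_ (+ Ω as) (suc (sum as) !) {{suc (sum as) !≢0}}

sumℚ : List ℚ → ℚ
sumℚ = foldr _+ℚ_ 0q

flat : List (ℕ × ℕ) → List ℕ
flat []             = []
flat ((i , j) ∷ ps) = i ∷ j ∷ flat ps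

decLast : List ℕ → List ℕ
decLast []           = []
decLast (x ∷ [])     = (x ∸ 1) ∷ []
decLast (x ∷ y ∷ xs) = x ∷ decLast (y ∷ xs)

decHead : List ℕ → List ℕ
decHead []       = []
decHead (x ∷ xs) = (x ∸ 1) ∷ xs

-- the k-th pair (0-based); default (0,0) out of range (never used there)
pairAt : List (ℕ × ℕ) → ℕ → ℕ × ℕ
pairAt []       k       = (0 , 0)
pairAt (p ∷ ps) zero    = p
pairAt (p ∷ ps) (suc k) = pairAt ps k

module Submission where

-- Two recursions for Ω' (Theorem 2), proved by locating the maximum.
--
-- Counting: every permutation of {0,…,n} arises exactly once by inserting n into
-- a permutation of {0,…,n-1} (count-insert), and complementing the values
-- v ↦ n-1-v permutes the permutations (count-complement).
-- Shapes: a shape is a list of up/down words governing unrelated blocks, and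
-- shapeCount sh counts the permutations fitting it.  The maximum sits at a peak
-- of some block, and deleting it leaves a permutation fitting the shape with
-- that peak removed (insert-fits); this gives the recurrence shapeCount-rec and
-- from it the binomial product rule for independent blocks (shapeCount-++).
-- Runs: Ω as is the shape count of the word of its run lengths, whichever
-- direction comes first (Ω≡shapeCount, Ω≡shapeCount-down).  In ↑^i₁↓^j₁…↓^jₙ the
-- peaks are the n tops of the ascending runs, in ↓^i₁↑^j₁…↑^jₙ the n+1 cuts
-- between pairs (splitSum-up, splitSum-down); removing a peak leaves two blocks,
-- each counted by an Ω, so each term is (binomial)·Ω·Ω.
-- Rationals: dividing by (N+1)! turns (binomial)·Ω·Ω / N! into Ω'·Ω' (/!-*),
-- which yields both formulas of theorem2.

open import Defs
open import Data.Bool using (Bool; true; false; _∧_; not; if_then_else_; T)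
open import Data.Bool.Properties using (T?; ∧-assoc; ∧-identityʳ; ∧-zeroʳ)
-- Multiplication of naturals is written _*ℕ_: in the theorem _*_ is multiplication of rationals.
open import Data.Nat using (ℕ; zero; suc; _+_; _∸_; _!; NonZero; _≡ᵇ_; _<ᵇ_; _≤_; _<_; z≤n; s≤s; s≤s⁻¹)
  renaming (_*_ to _*ℕ_)
open import Data.Nat.Properties
open import Data.Nat.ListAction using (sum)
open import Data.Nat.ListAction.Properties using (sum-++)
open import Data.Nat.Tactic.RingSolver using (solve-∀)
open import Data.List using (List; []; _∷_; _++_; length; take; drop; filterᵇ; concat; map; replicate; upTo; applyUpTo)
open import Data.List.Properties
  using (∷-injectiveˡ; ∷-injectiveʳ; ++-assoc; ++-identityʳ; length-++; length-++-sucʳ; length-take; length-drop;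
         length-map; length-replicate; length-upTo; take++drop≡id; drop-drop; drop-[]; map-∘; map-cong; map-cong-local;
         map-++; map-replicate)
open import Data.List.Membership.Propositional using (_∈_; _∉_)
open import Data.List.Membership.Propositional.Properties
open import Data.List.Membership.DecPropositional _≟_ using (_∈?_)
open import Data.List.Relation.Unary.Any as Any using (here; there)
open import Data.List.Relation.Unary.Any.Properties using (any⁺; any⁻)
open import Data.List.Relation.Unary.All as All using (All; []; _∷_)
import Data.List.Relation.Unary.All.Properties as All
open import Data.List.Relation.Unary.AllPairs as AllPairs using (AllPairs)
import Data.List.Relation.Unary.AllPairs.Properties as AllPairs
open import Data.List.Relation.Unary.Unique.Propositional using (Unique; []; _∷_)
import Data.List.Relation.Unary.Unique.Propositional.Properties as Unique
open import Data.List.Relation.Binary.Disjoint.Propositional using (Disjoint)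
open import Data.Product using (_×_; _,_; proj₁; proj₂; ∃₂)
open import Data.Empty using (⊥-elim)
open import Data.Unit using (tt)
open import Relation.Nullary using (yes; no)
open import Relation.Unary using (Decidable)
open import Relation.Binary.PropositionalEquality

count : {A : Set} → (A → Bool) → List A → ℕ
count P xs = length (filterᵇ P xs)

module _ {A : Set} where

  ∈-remove : ∀ {z x : A} (as bs : List A) → z ∈ as ++ x ∷ bs → z ≢ x → z ∈ as ++ bs
  ∈-remove []       bs (here z≡x)  z≢x = ⊥-elim (z≢x z≡x)
  ∈-remove []       bs (there z∈)  z≢x = z∈
  ∈-remove (a ∷ as) bs (here z≡a)  z≢x = here z≡a
  ∈-remove (a ∷ as) bs (there z∈)  z≢x = there (∈-remove as bs z∈ z≢x)

  unique-length-≤ : ∀ {xs ys : List A} → Unique xs → (∀ {z} → z ∈ xs → z ∈ ys) → length xs ≤ length ys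
  unique-length-≤ {[]}     _          _  = z≤n
  unique-length-≤ {x ∷ xs} (x∉ ∷ xs!) xs⊆ys with as , bs , refl ← ∈-∃++ (xs⊆ys (here refl)) =
    ≤-trans (s≤s (unique-length-≤ xs! λ z∈ → ∈-remove as bs (xs⊆ys (there z∈)) (λ { refl → All.lookup x∉ z∈ refl })))
            (≤-reflexive (sym (length-++-sucʳ as x bs)))

  count-cong : ∀ (P Q : A → Bool) xs → (∀ x → x ∈ xs → P x ≡ Q x) → count P xs ≡ count Q xs
  count-cong P Q []       _  = refl
  count-cong P Q (x ∷ xs) eq with P x | Q x | eq x (here refl)
  ... | true  | true  | _ = cong suc (count-cong P Q xs (λ y y∈ → eq y (there y∈)))
  ... | false | false | _ = count-cong P Q xs (λ y y∈ → eq y (there y∈))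

  count-const-∧ : ∀ (b : Bool) (Q : A → Bool) xs → count (λ x → b ∧ Q x) xs ≡ (if b then count Q xs else 0)
  count-const-∧ true  Q xs       = refl
  count-const-∧ false Q []       = refl
  count-const-∧ false Q (x ∷ xs) = count-const-∧ false Q xs

  count-++ : ∀ (P : A → Bool) xs ys → count P (xs ++ ys) ≡ count P xs + count P ys
  count-++ P []       ys = refl
  count-++ P (x ∷ xs) ys with P x
  ... | true  = cong suc (count-++ P xs ys)
  ... | false = count-++ P xs ys

  count-concat : ∀ (P : A → Bool) xss → count P (concat xss) ≡ sum (map (count P) xss)
  count-concat P []         = refl
  count-concat P (xs ∷ xss) = trans (count-++ P xs (concat xss)) (cong (count P xs +_) (count-concat P xss))

  count-≤ : ∀ (P : A → Bool) {xs ys} → Unique xs → (∀ {z} → z ∈ xs → T (P z) → z ∈ ys) → count P xs ≤ count P ys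
  count-≤ P xs! incl = unique-length-≤ (Unique.filter⁺ P? xs!) λ z∈ →
    let (z∈xs , Pz) = ∈-filter⁻ P? z∈ in ∈-filter⁺ P? (incl z∈xs Pz) Pz
    where
    P? : Decidable (λ z → T (P z))
    P? z = T? (P z)

  count-≡ : ∀ (P : A → Bool) {xs ys} → Unique xs → Unique ys →
    (∀ {z} → z ∈ xs → T (P z) → z ∈ ys) → (∀ {z} → z ∈ ys → T (P z) → z ∈ xs) → count P xs ≡ count P ys
  count-≡ P xs! ys! xs⊆ys ys⊆xs = ≤-antisym (count-≤ P xs! xs⊆ys) (count-≤ P ys! ys⊆xs)

module _ {A B : Set} where

  count-map : ∀ (P : B → Bool) (f : A → B) xs → count P (map f xs) ≡ count (λ x → P (f x)) xs
  count-map P f []       = refl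
  count-map P f (x ∷ xs) with P (f x)
  ... | true  = cong suc (count-map P f xs)
  ... | false = count-map P f xs

  map-unique : ∀ (f : A → B) {xs} → Unique xs → (∀ {x y} → x ∈ xs → y ∈ xs → f x ≡ f y → x ≡ y) → Unique (map f xs)
  map-unique f {[]}     []         inj = []
  map-unique f {x ∷ xs} (x∉ ∷ xs!) inj =
    All.map⁺ (All.tabulate (λ {y} y∈ fx≡fy → All.lookup x∉ y∈ (inj (here refl) (there y∈) fx≡fy)))
    ∷ map-unique f xs! (λ x∈ y∈ → inj (there x∈) (there y∈))

sumBelow : (ℕ → ℕ) → ℕ → ℕ
sumBelow f zero    = 0
sumBelow f (suc n) = f 0 + sumBelow (λ q → f (suc q)) n

sum-applyUpTo : ∀ (f g : ℕ → ℕ) n → sum (map f (applyUpTo g n)) ≡ sumBelow (λ q → f (g q)) n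
sum-applyUpTo f g zero    = refl
sum-applyUpTo f g (suc n) = cong (f (g 0) +_) (sum-applyUpTo f (λ q → g (suc q)) n)

sumBelow-+ : ∀ f m n → sumBelow f (m + n) ≡ sumBelow f m + sumBelow (λ q → f (m + q)) n
sumBelow-+ f zero    n = refl
sumBelow-+ f (suc m) n = trans (cong (f 0 +_) (sumBelow-+ (λ q → f (suc q)) m n)) (sym (+-assoc (f 0) _ _))

sumBelow-cong : ∀ f g n → (∀ q → q < n → f q ≡ g q) → sumBelow f n ≡ sumBelow g n
sumBelow-cong f g zero    eq = refl
sumBelow-cong f g (suc n) eq = cong₂ _+_ (eq 0 (s≤s z≤n)) (sumBelow-cong _ _ n (λ q q<n → eq (suc q) (s≤s q<n)))

sumBelow-* : ∀ c f n → sumBelow (λ q → c *ℕ f q) n ≡ c *ℕ sumBelow f n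
sumBelow-* c f zero    = sym (*-zeroʳ c)
sumBelow-* c f (suc n) = trans (cong (c *ℕ f 0 +_) (sumBelow-* c (λ q → f (suc q)) n)) (sym (*-distribˡ-+ c (f 0) _))

Perm : ℕ → List (List ℕ)
Perm n = filterᵇ distinct (allLists n n)

IsPerm : ℕ → List ℕ → Set
IsPerm n l = length l ≡ n × All (_< n) l × Unique l

∈-allLists⁺ : ∀ {k m} (l : List ℕ) → length l ≡ k → All (_< m) l → l ∈ allLists k m
∈-allLists⁺ {zero}      []      refl []           = here refl
∈-allLists⁺ {suc k} {m} (x ∷ l) refl (x<m ∷ l<m) =
  ∈-concat⁺′ (∈-map⁺ (x ∷_) (∈-allLists⁺ l refl l<m)) (∈-map⁺ (λ y → map (y ∷_) (allLists k m)) (∈-upTo⁺ x<m))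

∈-allLists⁻ : ∀ {k m} (l : List ℕ) → l ∈ allLists k m → length l ≡ k × All (_< m) l
∈-allLists⁻ {zero}      .[] (here refl) = refl , []
∈-allLists⁻ {suc k} {m} l   l∈
  with xs , l∈xs , xs∈ ← ∈-concat⁻′ (map (λ y → map (y ∷_) (allLists k m)) (upTo m)) l∈
  with x , x∈ , refl ← ∈-map⁻ (λ y → map (y ∷_) (allLists k m)) xs∈
  with l′ , l′∈ , refl ← ∈-map⁻ (x ∷_) l∈xs
  with len , l′<m ← ∈-allLists⁻ l′ l′∈ = cong suc len , ∈-upTo⁻ x∈ ∷ l′<m

allLists-unique : ∀ k m → Unique (allLists k m)
allLists-unique zero    m = [] ∷ []
allLists-unique (suc k) m = Unique.concat⁺ blocks-unique blocks-disjoint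
  where
  block : ℕ → List (List ℕ)
  block x = map (x ∷_) (allLists k m)
  blocks-unique : All Unique (map block (upTo m))
  blocks-unique = All.map⁺ (All.universal (λ x → Unique.map⁺ ∷-injectiveʳ (allLists-unique k m)) (upTo m))
  disjoint : ∀ {x y} → x ≢ y → Disjoint (block x) (block y)
  disjoint x≢y (l∈x , l∈y) with _ , _ , refl ← ∈-map⁻ _ l∈x | _ , _ , eq ← ∈-map⁻ _ l∈y = x≢y (∷-injectiveˡ eq)
  blocks-disjoint : AllPairs.AllPairs Disjoint (map block (upTo m))
  blocks-disjoint = AllPairs.map⁺ (AllPairs.map (λ x≢y {l} → disjoint x≢y {l}) (Unique.upTo⁺ m))

elem⇒∈ : ∀ x xs → T (elem x xs) → x ∈ xs
elem⇒∈ x xs t = Any.map (λ {y} → ≡ᵇ⇒≡ x y) (any⁻ (x ≡ᵇ_) xs t)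

∈⇒elem : ∀ {x xs} → x ∈ xs → T (elem x xs)
∈⇒elem {x} x∈ = any⁺ (x ≡ᵇ_) (Any.map (λ { refl → ≡⇒≡ᵇ x x refl }) x∈)

distinct⇒unique : ∀ l → T (distinct l) → Unique l
distinct⇒unique []       _ = []
distinct⇒unique (x ∷ xs) t with elem x xs in eq
... | false = All.tabulate (λ { y∈ refl → subst T eq (∈⇒elem y∈) }) ∷ distinct⇒unique xs t

unique⇒distinct : ∀ l → Unique l → T (distinct l)
unique⇒distinct []       _          = tt
unique⇒distinct (x ∷ xs) (x∉ ∷ xs!) with elem x xs in eq
... | false = unique⇒distinct xs xs!
... | true  = All.lookup x∉ (elem⇒∈ x xs (subst T (sym eq) tt)) refl

∈-Perm⁺ : ∀ {n} l → IsPerm n l → l ∈ Perm n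
∈-Perm⁺ l (len , l<n , l!) = ∈-filter⁺ (λ l → T? (distinct l)) (∈-allLists⁺ l len l<n) (unique⇒distinct l l!)

∈-Perm⁻ : ∀ {n} l → l ∈ Perm n → IsPerm n l
∈-Perm⁻ {n} l l∈ with l∈all , t ← ∈-filter⁻ (λ l → T? (distinct l)) {xs = allLists n n} l∈
  with len , l<n ← ∈-allLists⁻ l l∈all = len , l<n , distinct⇒unique l t

Perm-unique : ∀ n → Unique (Perm n)
Perm-unique n = Unique.filter⁺ (λ l → T? (distinct l)) (allLists-unique n n)

insert : ℕ → ℕ → List ℕ → List ℕ
insert p m σ = take p σ ++ m ∷ drop p σ

take-length : ∀ {A : Set} p (l : List A) → p ≤ length l → length (take p l) ≡ p
take-length p l p≤ = trans (length-take p l) (m≤n⇒m⊓n≡m p≤)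

split-at-fresh : ∀ {m : ℕ} (a c : List ℕ) {b d} → a ++ m ∷ b ≡ c ++ m ∷ d → m ∉ a → m ∉ c → a ≡ c × b ≡ d
split-at-fresh []      []      eq m∉a m∉c = refl , ∷-injectiveʳ eq
split-at-fresh []      (x ∷ c) eq m∉a m∉c = ⊥-elim (m∉c (here (∷-injectiveˡ eq)))
split-at-fresh (x ∷ a) []      eq m∉a m∉c = ⊥-elim (m∉a (here (sym (∷-injectiveˡ eq))))
split-at-fresh (x ∷ a) (y ∷ c) eq m∉a m∉c
  with refl ← ∷-injectiveˡ eq
  with refl , b≡d ← split-at-fresh a c (∷-injectiveʳ eq) (λ m∈ → m∉a (there m∈)) (λ m∈ → m∉c (there m∈)) = refl , b≡d

bounded⇒∉ : ∀ {n} {a : List ℕ} → All (_< n) a → n ∉ a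
bounded⇒∉ a<n n∈a = <-irrefl refl (All.lookup a<n n∈a)

insert-injective : ∀ {n p q σ τ} → p ≤ n → q ≤ n → IsPerm n σ → IsPerm n τ →
  insert p n σ ≡ insert q n τ → p ≡ q × σ ≡ τ
insert-injective {n} {p} {q} {σ} {τ} p≤n q≤n (lenσ , σ<n , _) (lenτ , τ<n , _) eq
  with take≡ , drop≡ ← split-at-fresh (take p σ) (take q τ) eq (bounded⇒∉ (All.take⁺ p σ<n)) (bounded⇒∉ (All.take⁺ q τ<n)) =
  p≡q , trans (sym (take++drop≡id p σ)) (trans (cong₂ _++_ take≡ drop≡) (take++drop≡id q τ))
  where
  p≡q : p ≡ q
  p≡q = trans (sym (take-length p σ (subst (p ≤_) (sym lenσ) p≤n)))
          (trans (cong length take≡) (take-length q τ (subst (q ≤_) (sym lenτ) q≤n)))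

insert-unique : ∀ (a b : List ℕ) x → Unique (a ++ b) → All (x ≢_) (a ++ b) → Unique (a ++ x ∷ b)
insert-unique []      b x ab!          x∉ = x∉ ∷ ab!
insert-unique (y ∷ a) b x (y∉ ∷ ab!) (x≢y ∷ x∉) =
  All.++⁺ (All.++⁻ˡ a y∉) ((λ y≡x → x≢y (sym y≡x)) ∷ All.++⁻ʳ a y∉) ∷ insert-unique a b x ab! x∉

remove-unique : ∀ (a b : List ℕ) x → Unique (a ++ x ∷ b) → Unique (a ++ b) × All (x ≢_) (a ++ b)
remove-unique []      b x (x∉ ∷ b!)   = b! , x∉
remove-unique (y ∷ a) b x (y∉ ∷ axb!) with ab! , x∉ ← remove-unique a b x axb! =
  All.++⁺ (All.++⁻ˡ a y∉) (All.tail (All.++⁻ʳ a y∉)) ∷ ab! ,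
  (λ x≡y → All.head (All.++⁻ʳ a y∉) (sym x≡y)) ∷ x∉

insert-IsPerm : ∀ n p σ → p ≤ n → IsPerm n σ → IsPerm (suc n) (insert p n σ)
insert-IsPerm n p σ p≤n (lenσ , σ<n , σ!) = len , bounded , unique
  where
  σ≡ : take p σ ++ drop p σ ≡ σ
  σ≡ = take++drop≡id p σ
  σ<1+n : All (_< suc n) σ
  σ<1+n = All.map m≤n⇒m≤1+n σ<n
  len : length (insert p n σ) ≡ suc n
  len = trans (length-++-sucʳ (take p σ) n (drop p σ)) (cong suc (trans (cong length σ≡) lenσ))
  bounded : All (_< suc n) (insert p n σ)
  bounded = All.++⁺ (All.take⁺ p σ<1+n) (n<1+n n ∷ All.drop⁺ p σ<1+n)
  unique : Unique (insert p n σ)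
  unique = insert-unique (take p σ) (drop p σ) n (subst Unique (sym σ≡) σ!)
             (subst (All (n ≢_)) (sym σ≡) (All.map (λ y<n n≡y → <-irrefl (sym n≡y) y<n) σ<n))

-- A permutation of {0,…,n} contains n (pigeonhole).
max-∈ : ∀ n l → IsPerm (suc n) l → n ∈ l
max-∈ n l (len , l<1+n , l!) with n ∈? l
... | yes n∈l = n∈l
... | no  n∉l = ⊥-elim (<-irrefl refl (begin-strict
    n            <⟨ n<1+n n ⟩
    suc n        ≡⟨ sym len ⟩
    length l     ≤⟨ unique-length-≤ l! (λ y∈ → ∈-upTo⁺ (All.lookup l<n y∈)) ⟩
    length (upTo n) ≡⟨ length-upTo n ⟩
    n            ∎))
  where
  open ≤-Reasoning
  l<n : All (_< n) l
  l<n = All.tabulate (λ {y} y∈ → ≤∧≢⇒< (s≤s⁻¹ (All.lookup l<1+n y∈)) (λ { refl → n∉l y∈ }))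

remove-max : ∀ n l → IsPerm (suc n) l → ∃₂ λ p σ → p ≤ n × IsPerm n σ × l ≡ insert p n σ
remove-max n l perm@(len , l<1+n , l!) with as , bs , refl ← ∈-∃++ (max-∈ n l perm)
  with ab! , n∉ ← remove-unique as bs n l! =
  length as , as ++ bs , p≤n , (lenσ , σ<n , ab!) , sym (insert-length as bs)
  where
  insert-length : ∀ (a b : List ℕ) → insert (length a) n (a ++ b) ≡ a ++ n ∷ b
  insert-length []      b = refl
  insert-length (y ∷ a) b = cong (y ∷_) (insert-length a b)
  lenσ : length (as ++ bs) ≡ n
  lenσ = suc-injective (trans (sym (length-++-sucʳ as n bs)) len)
  σ<n : All (_< n) (as ++ bs)
  σ<n = All.zipWith (λ (y<1+n , n≢y) → ≤∧≢⇒< (s≤s⁻¹ y<1+n) (λ y≡n → n≢y (sym y≡n)))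
          (All.++⁺ (All.++⁻ˡ as l<1+n) (All.tail (All.++⁻ʳ as l<1+n)) , n∉)
  p≤n : length as ≤ n
  p≤n = subst (length as ≤_) lenσ (subst (length as ≤_) (sym (length-++ as)) (m≤m+n (length as) (length bs)))

insertions : ℕ → List (List ℕ)
insertions n = concat (map (λ p → map (insert p n) (Perm n)) (upTo (suc n)))

insertions-unique : ∀ n → Unique (insertions n)
insertions-unique n = Unique.concat⁺ (All.map⁺ (All.tabulate block-unique)) (AllPairs.map⁺ blocks-disjoint)
  where
  block-unique : ∀ {p} → p ∈ upTo (suc n) → Unique (map (insert p n) (Perm n))
  block-unique p∈ = map-unique (insert _ n) (Perm-unique n) λ σ∈ τ∈ eq →
    let p≤n = s≤s⁻¹ (∈-upTo⁻ p∈) in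
    proj₂ (insert-injective p≤n p≤n (∈-Perm⁻ _ σ∈) (∈-Perm⁻ _ τ∈) eq)
  disjoint : ∀ {p q} → p < q → q < suc n → Disjoint (map (insert p n) (Perm n)) (map (insert q n) (Perm n))
  disjoint p<q q<1+n (l∈p , l∈q) with σ , σ∈ , refl ← ∈-map⁻ _ l∈p | τ , τ∈ , eq ← ∈-map⁻ _ l∈q =
    <-irrefl (proj₁ (insert-injective (≤-trans (<⇒≤ p<q) (s≤s⁻¹ q<1+n)) (s≤s⁻¹ q<1+n)
                                      (∈-Perm⁻ σ σ∈) (∈-Perm⁻ τ τ∈) eq)) p<q
  blocks-disjoint : AllPairs.AllPairs (λ p q → Disjoint (map (insert p n) (Perm n)) (map (insert q n) (Perm n))) (upTo (suc n))
  blocks-disjoint = AllPairs.applyUpTo⁺₁ (λ p → p) (suc n) (λ p<q q<1+n {l} → disjoint p<q q<1+n {l})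

count-insert : ∀ (P : List ℕ → Bool) n →
  count P (Perm (suc n)) ≡ sum (map (λ p → count (λ σ → P (insert p n σ)) (Perm n)) (upTo (suc n)))
count-insert P n = begin
    count P (Perm (suc n))
  ≡⟨ count-≡ P (Perm-unique (suc n)) (insertions-unique n) (λ l∈ _ → perm⇒insertion l∈) (λ l∈ _ → insertion⇒perm l∈) ⟩
    count P (insertions n)
  ≡⟨ count-concat P (map (λ p → map (insert p n) (Perm n)) (upTo (suc n))) ⟩
    sum (map (count P) (map (λ p → map (insert p n) (Perm n)) (upTo (suc n))))
  ≡⟨ cong sum (trans (sym (map-∘ (upTo (suc n)))) (map-cong (λ p → count-map P (insert p n) (Perm n)) (upTo (suc n)))) ⟩
    sum (map (λ p → count (λ σ → P (insert p n σ)) (Perm n)) (upTo (suc n)))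
  ∎
  where
  open ≡-Reasoning
  perm⇒insertion : ∀ {l} → l ∈ Perm (suc n) → l ∈ insertions n
  perm⇒insertion {l} l∈ with p , σ , p≤n , σ-perm , refl ← remove-max n l (∈-Perm⁻ l l∈) =
    ∈-concat⁺′ (∈-map⁺ (insert p n) (∈-Perm⁺ σ σ-perm)) (∈-map⁺ (λ q → map (insert q n) (Perm n)) (∈-upTo⁺ (s≤s p≤n)))
  insertion⇒perm : ∀ {l} → l ∈ insertions n → l ∈ Perm (suc n)
  insertion⇒perm l∈
    with ls , l∈ls , ls∈ ← ∈-concat⁻′ (map (λ p → map (insert p n) (Perm n)) (upTo (suc n))) l∈
    with p , p∈ , refl ← ∈-map⁻ (λ p → map (insert p n) (Perm n)) ls∈
    with σ , σ∈ , refl ← ∈-map⁻ (insert p n) l∈ls =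
    ∈-Perm⁺ (insert p n σ) (insert-IsPerm n p σ (s≤s⁻¹ (∈-upTo⁻ p∈)) (∈-Perm⁻ σ σ∈))

complement : ℕ → ℕ → ℕ
complement n v = n ∸ suc v

complement-involutive : ∀ n v → v < n → complement n (complement n v) ≡ v
complement-involutive (suc n) v (s≤s v≤n) = m∸[m∸n]≡n v≤n

complement-< : ∀ n v → v < n → complement n v < n
complement-< (suc n) v _ = s≤s (m∸n≤m n v)

complement-injective : ∀ n {x y} → x < n → y < n → complement n x ≡ complement n y → x ≡ y
complement-injective (suc n) (s≤s x≤n) (s≤s y≤n) eq = ∸-cancelˡ-≡ x≤n y≤n eq

complement-IsPerm : ∀ n l → IsPerm n l → IsPerm n (map (complement n) l)
complement-IsPerm n l (len , l<n , l!) =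
  trans (length-map (complement n) l) len ,
  All.map⁺ (All.map (complement-< n _) l<n) ,
  map-unique (complement n) l! (λ x∈ y∈ → complement-injective n (All.lookup l<n x∈) (All.lookup l<n y∈))

complement-twice : ∀ n l → All (_< n) l → map (complement n) (map (complement n) l) ≡ l
complement-twice n []      []             = refl
complement-twice n (x ∷ l) (x<n ∷ l<n) = cong₂ _∷_ (complement-involutive n x x<n) (complement-twice n l l<n)

-- Complementing all values is a bijection of Perm n, so it preserves counts.
count-complement : ∀ (P : List ℕ → Bool) n → count P (Perm n) ≡ count (λ l → P (map (complement n) l)) (Perm n)
count-complement P n = ≤-antisym
  (complement-≤ P Q (λ l l-perm Pl → subst (λ z → T (P z)) (sym (complement-twice n l (proj₁ (proj₂ l-perm)))) Pl))
  (complement-≤ Q P (λ l _ Ql → Ql))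
  where
  Q : List ℕ → Bool
  Q l = P (map (complement n) l)
  complement-≤ : ∀ (R S : List ℕ → Bool) → (∀ l → IsPerm n l → T (R l) → T (S (map (complement n) l))) →
    count R (Perm n) ≤ count S (Perm n)
  complement-≤ R S R⇒S = begin
      count R (Perm n)
    ≤⟨ unique-length-≤ (Unique.filter⁺ (λ l → T? (R l)) (Perm-unique n)) incl ⟩
      length (map (map (complement n)) (filterᵇ S (Perm n)))
    ≡⟨ length-map (map (complement n)) (filterᵇ S (Perm n)) ⟩
      count S (Perm n)
    ∎
    where
    open ≤-Reasoning
    incl : ∀ {l} → l ∈ filterᵇ R (Perm n) → l ∈ map (map (complement n)) (filterᵇ S (Perm n))
    incl {l} l∈ with l∈Perm , Rl ← ∈-filter⁻ (λ l → T? (R l)) l∈ =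
      let l-perm = ∈-Perm⁻ l l∈Perm in
      subst (_∈ map (map (complement n)) (filterᵇ S (Perm n))) (complement-twice n l (proj₁ (proj₂ l-perm)))
        (∈-map⁺ (map (complement n)) (∈-filter⁺ (λ l → T? (S l)) (∈-Perm⁺ _ (complement-IsPerm n l l-perm)) (R⇒S l l-perm Rl)))

-- An up/down word: the i-th letter says whether step i of a sequence ascends.
Word : Set
Word = List Bool

step : Bool → ℕ → ℕ → Bool
step true  x y = x <ᵇ y
step false x y = y <ᵇ x

fitsWord : Word → List ℕ → Bool
fitsWord []      l           = true
fitsWord (b ∷ w) []          = true
fitsWord (b ∷ w) (x ∷ [])    = true
fitsWord (b ∷ w) (x ∷ y ∷ l) = step b x y ∧ fitsWord w (y ∷ l)

-- A shape is a sequence of words; a word of length k governs a block of k+1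
-- consecutive entries, and consecutive blocks are unrelated.
Shape : Set
Shape = List Word

size : Shape → ℕ
size []       = 0
size (w ∷ sh) = suc (length w) + size sh

fitsShape : Shape → List ℕ → Bool
fitsShape []       l = true
fitsShape (w ∷ sh) l = fitsWord w l ∧ fitsShape sh (drop (suc (length w)) l)

shapeCount : Shape → ℕ
shapeCount sh = count (fitsShape sh) (Perm (size sh))

-- A cut wl | wr of a word marks a peak when the step into the cut position
-- ascends and the step out of it descends (a missing step imposes nothing).
endsUp : Word → Bool
endsUp []          = true
endsUp (b ∷ [])    = b
endsUp (b ∷ c ∷ w) = endsUp (c ∷ w)

startsDown : Word → Bool
startsDown []      = true
startsDown (b ∷ _) = not b

peak : Word → Word → Bool
peak wl wr = endsUp wl ∧ startsDown wr

-- Removing a peak splits its word in two: the left part loses its last letter,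
-- the right part its first.  An empty side contributes no block.
init : Bool → Word → Word
init b []      = []
init b (c ∷ w) = b ∷ init c w

leftPart : Word → Shape
leftPart []      = []
leftPart (b ∷ w) = init b w ∷ []

rightPart : Word → Shape
rightPart []      = []
rightPart (b ∷ w) = w ∷ []

size-++ : ∀ s₁ s₂ → size (s₁ ++ s₂) ≡ size s₁ + size s₂
size-++ []       s₂ = refl
size-++ (w ∷ s₁) s₂ = trans (cong (suc (length w) +_) (size-++ s₁ s₂)) (sym (+-assoc (suc (length w)) (size s₁) (size s₂)))

size-leftPart : ∀ w → size (leftPart w) ≡ length w
size-leftPart []      = refl
size-leftPart (b ∷ w) = cong suc (trans (+-identityʳ _) (length-init b w))
  where
  length-init : ∀ b w → length (init b w) ≡ length w
  length-init b []      = refl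
  length-init b (c ∷ w) = cong suc (length-init c w)

size-rightPart : ∀ w → size (rightPart w) ≡ length w
size-rightPart []      = refl
size-rightPart (b ∷ w) = cong suc (+-identityʳ _)

fitsWord-[] : ∀ w → fitsWord w [] ≡ true
fitsWord-[] []      = refl
fitsWord-[] (b ∷ w) = refl

fitsWord-prefix : ∀ w (l r : List ℕ) → suc (length w) ≤ length l → fitsWord w (l ++ r) ≡ fitsWord w l
fitsWord-prefix []      l           r _         = refl
fitsWord-prefix (b ∷ w) (x ∷ y ∷ l) r (s≤s len) = cong (step b x y ∧_) (fitsWord-prefix w (y ∷ l) r len)

drop-prefix : ∀ k (l r : List ℕ) → k ≤ length l → drop k (l ++ r) ≡ drop k l ++ r
drop-prefix zero    l       r _         = refl
drop-prefix (suc k) (x ∷ l) r (s≤s k≤l) = drop-prefix k l r k≤l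

drop-length : ∀ (l r : List ℕ) → drop (length l) (l ++ r) ≡ r
drop-length []      r = refl
drop-length (x ∷ l) r = drop-length l r

fitsShape-prefix : ∀ sh (l r : List ℕ) → size sh ≤ length l → fitsShape sh (l ++ r) ≡ fitsShape sh l
fitsShape-prefix []       l r _   = refl
fitsShape-prefix (w ∷ sh) l r len = cong₂ _∧_ (fitsWord-prefix w l r k≤l)
  (trans (cong (fitsShape sh) (drop-prefix k l r k≤l))
         (fitsShape-prefix sh (drop k l) r (subst (size sh ≤_) (sym (length-drop k l)) rest≤)))
  where
  k : ℕ
  k = suc (length w)
  k≤l : k ≤ length l
  k≤l = ≤-trans (m≤m+n k (size sh)) len
  rest≤ : size sh ≤ length l ∸ k
  rest≤ = subst (_≤ length l ∸ k) (m+n∸m≡n k (size sh)) (∸-monoˡ-≤ k len)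

fitsShape-++ : ∀ s₁ s₂ (l : List ℕ) → fitsShape (s₁ ++ s₂) l ≡ fitsShape s₁ l ∧ fitsShape s₂ (drop (size s₁) l)
fitsShape-++ []       s₂ l = refl
fitsShape-++ (w ∷ s₁) s₂ l = trans
  (cong (fitsWord w l ∧_) (trans (fitsShape-++ s₁ s₂ (drop k l))
    (cong (λ r → fitsShape s₁ (drop k l) ∧ fitsShape s₂ r) (drop-drop k (size s₁) l))))
  (sym (∧-assoc (fitsWord w l) _ _))
  where
  k : ℕ
  k = suc (length w)

fitsShape-++-exact : ∀ s₁ s₂ (l r : List ℕ) → size s₁ ≡ length l → fitsShape (s₁ ++ s₂) (l ++ r) ≡ fitsShape s₁ l ∧ fitsShape s₂ r
fitsShape-++-exact s₁ s₂ l r size≡ = begin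
    fitsShape (s₁ ++ s₂) (l ++ r)
  ≡⟨ fitsShape-++ s₁ s₂ (l ++ r) ⟩
    fitsShape s₁ (l ++ r) ∧ fitsShape s₂ (drop (size s₁) (l ++ r))
  ≡⟨ cong₂ (λ a k → a ∧ fitsShape s₂ (drop k (l ++ r))) (fitsShape-prefix s₁ l r (≤-reflexive size≡)) size≡ ⟩
    fitsShape s₁ l ∧ fitsShape s₂ (drop (length l) (l ++ r))
  ≡⟨ cong (λ z → fitsShape s₁ l ∧ fitsShape s₂ z) (drop-length l r) ⟩
    fitsShape s₁ l ∧ fitsShape s₂ r
  ∎
  where open ≡-Reasoning

∧-pull-inward : ∀ a e l t f → a ∧ ((e ∧ (l ∧ t)) ∧ f) ≡ (e ∧ ((a ∧ l) ∧ t)) ∧ f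
∧-pull-inward true  e     l t f = refl
∧-pull-inward false true  l t f = refl
∧-pull-inward false false l t f = refl

∧-regroup : ∀ e l s r x → ((e ∧ l) ∧ (s ∧ r)) ∧ x ≡ (e ∧ s) ∧ (l ∧ (r ∧ x))
∧-regroup true  true  true  r x = refl
∧-regroup true  true  false r x = refl
∧-regroup true  false true  r x = refl
∧-regroup true  false false r x = refl
∧-regroup false l     s     r x = refl

∧-swap : ∀ a b c → a ∧ (b ∧ c) ≡ b ∧ (a ∧ c)
∧-swap true  b c = refl
∧-swap false true  c = refl
∧-swap false false c = refl

<ᵇ-true : ∀ {x y} → x < y → (x <ᵇ y) ≡ true
<ᵇ-true {x} {y} x<y with x <ᵇ y in eq
... | true  = refl
... | false = ⊥-elim (subst T eq (<⇒<ᵇ x<y))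

<ᵇ-false : ∀ {x y} → y ≤ x → (x <ᵇ y) ≡ false
<ᵇ-false {x} {y} y≤x with x <ᵇ y in eq
... | false = refl
... | true  = ⊥-elim (<-irrefl refl (<-≤-trans (<ᵇ⇒< x y (subst T (sym eq) _)) y≤x))

step-into-max : ∀ b {x m} → x < m → step b x m ≡ b
step-into-max true  x<m = <ᵇ-true x<m
step-into-max false x<m = <ᵇ-false (<⇒≤ x<m)

step-out-of-max : ∀ b {m y} → y < m → step b m y ≡ not b
step-out-of-max true  y<m = <ᵇ-false (<⇒≤ y<m)
step-out-of-max false y<m = <ᵇ-true y<m

fits-left-of-max : ∀ m wl wr (τl rest : List ℕ) → length τl ≡ length wl → All (_< m) τl →
  fitsWord (wl ++ wr) (τl ++ m ∷ rest) ≡ (endsUp wl ∧ fitsShape (leftPart wl) τl) ∧ fitsWord wr (m ∷ rest)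
fits-left-of-max m []          wr []          rest _   _ = refl
fits-left-of-max m (b ∷ [])    wr (x ∷ [])    rest _   (x<m ∷ []) rewrite step-into-max b x<m | ∧-identityʳ b = refl
fits-left-of-max m (b ∷ c ∷ w) wr (x ∷ y ∷ τ) rest len (_ ∷ τ<m) =
  trans (cong (step b x y ∧_) (fits-left-of-max m (c ∷ w) wr (y ∷ τ) rest (suc-injective len) τ<m))
        (∧-pull-inward (step b x y) (endsUp (c ∷ w)) (fitsWord (init c w) (y ∷ τ)) true (fitsWord wr (m ∷ rest)))

fits-right-of-max : ∀ m wr (τr ρ : List ℕ) → length τr ≡ length wr → All (_< m) τr →
  fitsWord wr (m ∷ τr ++ ρ) ≡ startsDown wr ∧ fitsShape (rightPart wr) (τr ++ ρ)
fits-right-of-max m []      []      ρ _ _ = refl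
fits-right-of-max m (b ∷ w) (y ∷ τ) ρ _ (y<m ∷ _)
  rewrite step-out-of-max b y<m | ∧-identityʳ (fitsWord w (y ∷ τ ++ ρ)) = refl

fits-max-in-block : ∀ m wl wr sh (τl τr ρ : List ℕ) → length τl ≡ length wl → length τr ≡ length wr →
  All (_< m) τl → All (_< m) τr →
  fitsShape ((wl ++ wr) ∷ sh) (τl ++ m ∷ τr ++ ρ) ≡ peak wl wr ∧ fitsShape (leftPart wl ++ rightPart wr ++ sh) (τl ++ τr ++ ρ)
fits-max-in-block m wl wr sh τl τr ρ lenl lenr τl<m τr<m = begin
    fitsWord (wl ++ wr) (τl ++ m ∷ τr ++ ρ) ∧ fitsShape sh (drop (suc (length (wl ++ wr))) (τl ++ m ∷ τr ++ ρ))
  ≡⟨ cong₂ _∧_ (fits-left-of-max m wl wr τl (τr ++ ρ) lenl τl<m) (cong (fitsShape sh) drop-block) ⟩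
    ((endsUp wl ∧ fitsShape (leftPart wl) τl) ∧ fitsWord wr (m ∷ τr ++ ρ)) ∧ fitsShape sh ρ
  ≡⟨ cong (λ z → ((endsUp wl ∧ fitsShape (leftPart wl) τl) ∧ z) ∧ fitsShape sh ρ) (fits-right-of-max m wr τr ρ lenr τr<m) ⟩
    ((endsUp wl ∧ fitsShape (leftPart wl) τl) ∧ (startsDown wr ∧ fitsShape (rightPart wr) (τr ++ ρ))) ∧ fitsShape sh ρ
  ≡⟨ ∧-regroup (endsUp wl) (fitsShape (leftPart wl) τl) (startsDown wr) (fitsShape (rightPart wr) (τr ++ ρ)) (fitsShape sh ρ) ⟩
    peak wl wr ∧ (fitsShape (leftPart wl) τl ∧ (fitsShape (rightPart wr) (τr ++ ρ) ∧ fitsShape sh ρ))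
  ≡⟨ cong (peak wl wr ∧_) (sym split-rest) ⟩
    peak wl wr ∧ fitsShape (leftPart wl ++ rightPart wr ++ sh) (τl ++ τr ++ ρ)
  ∎
  where
  open ≡-Reasoning
  block-length : suc (length (wl ++ wr)) ≡ length (τl ++ m ∷ τr)
  block-length = trans (cong suc (length-++ wl))
    (sym (trans (length-++ τl) (trans (cong₂ _+_ lenl (cong suc lenr)) (+-suc _ _))))
  drop-block : drop (suc (length (wl ++ wr))) (τl ++ m ∷ τr ++ ρ) ≡ ρ
  drop-block = trans (cong₂ drop block-length (sym (++-assoc τl (m ∷ τr) ρ))) (drop-length (τl ++ m ∷ τr) ρ)
  split-rest : fitsShape (leftPart wl ++ rightPart wr ++ sh) (τl ++ τr ++ ρ)
             ≡ fitsShape (leftPart wl) τl ∧ (fitsShape (rightPart wr) (τr ++ ρ) ∧ fitsShape sh ρ)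
  split-rest = trans (fitsShape-++-exact (leftPart wl) (rightPart wr ++ sh) τl (τr ++ ρ) (trans (size-leftPart wl) (sym lenl)))
    (cong (fitsShape (leftPart wl) τl ∧_) (trans (fitsShape-++-exact (rightPart wr) sh τr ρ sizeʳ)
      (cong (_∧ fitsShape sh ρ) (sym (fitsShape-prefix (rightPart wr) τr ρ (≤-reflexive sizeʳ))))))
    where
    sizeʳ : size (rightPart wr) ≡ length τr
    sizeʳ = trans (size-rightPart wr) (sym lenr)

isPeak : Shape → ℕ → Bool
isPeak []       p = false
isPeak (w ∷ sh) p = if p <ᵇ suc (length w) then peak (take p w) (drop p w) else isPeak sh (p ∸ suc (length w))

removePeak : Shape → ℕ → Shape
removePeak []       p = []
removePeak (w ∷ sh) p =
  if p <ᵇ suc (length w) then leftPart (take p w) ++ rightPart (drop p w) ++ sh else w ∷ removePeak sh (p ∸ suc (length w))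

module Beyond (w : Word) (sh : Shape) (p : ℕ) (beyond : (p <ᵇ suc (length w)) ≡ false) where

  k : ℕ
  k = suc (length w)

  k≤p : k ≤ p
  k≤p = ≮⇒≥ (λ p<k → subst T beyond (<⇒<ᵇ p<k))

  shift : k + (p ∸ k) ≡ p
  shift = m+[n∸m]≡n k≤p

  within : p < size (w ∷ sh) → p ∸ k < size sh
  within p< = +-cancelˡ-< k (p ∸ k) (size sh) (subst (_< k + size sh) (sym shift) p<)

insert-in-first-block : ∀ m w sh p (σ : List ℕ) → p ≤ length w → length σ ≡ length w + size sh → All (_< m) σ →
  fitsShape (w ∷ sh) (insert p m σ) ≡ peak (take p w) (drop p w) ∧ fitsShape (leftPart (take p w) ++ rightPart (drop p w) ++ sh) σ
insert-in-first-block m w sh p σ p≤w lenσ σ<m = begin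
    fitsShape (w ∷ sh) (take p σ ++ m ∷ drop p σ)
  ≡⟨ cong₂ (λ w′ r → fitsShape (w′ ∷ sh) (take p σ ++ m ∷ r))
           (sym (take++drop≡id p w)) (sym (take++drop≡id (length wr) (drop p σ))) ⟩
    fitsShape ((wl ++ wr) ∷ sh) (τl ++ m ∷ τr ++ ρ)
  ≡⟨ fits-max-in-block m wl wr sh τl τr ρ lenl lenr (All.take⁺ p σ<m) (All.take⁺ (length wr) (All.drop⁺ p σ<m)) ⟩
    peak wl wr ∧ fitsShape (leftPart wl ++ rightPart wr ++ sh) (τl ++ τr ++ ρ)
  ≡⟨ cong (λ z → peak wl wr ∧ fitsShape (leftPart wl ++ rightPart wr ++ sh) (τl ++ z)) (take++drop≡id (length wr) (drop p σ)) ⟩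
    peak wl wr ∧ fitsShape (leftPart wl ++ rightPart wr ++ sh) (τl ++ drop p σ)
  ≡⟨ cong (λ z → peak wl wr ∧ fitsShape (leftPart wl ++ rightPart wr ++ sh) z) (take++drop≡id p σ) ⟩
    peak wl wr ∧ fitsShape (leftPart wl ++ rightPart wr ++ sh) σ
  ∎
  where
  open ≡-Reasoning
  wl wr : Word
  wl = take p w
  wr = drop p w
  τl τr ρ : List ℕ
  τl = take p σ
  τr = take (length wr) (drop p σ)
  ρ  = drop (length wr) (drop p σ)
  w≤σ : length w ≤ length σ
  w≤σ = ≤-trans (m≤m+n _ _) (≤-reflexive (sym lenσ))
  lenl : length τl ≡ length wl
  lenl = trans (take-length p σ (≤-trans p≤w w≤σ)) (sym (take-length p w p≤w))
  lenr : length τr ≡ length wr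
  lenr = take-length (length wr) (drop p σ)
           (subst₂ _≤_ (sym (length-drop p w)) (sym (length-drop p σ)) (∸-monoˡ-≤ p w≤σ))

fits-first-block : ∀ w sh (σ X : List ℕ) → suc (length w) ≤ length σ →
  fitsShape (w ∷ sh) (take (suc (length w)) σ ++ X) ≡ fitsWord w σ ∧ fitsShape sh X
fits-first-block w sh σ X k≤σ = cong₂ _∧_
  (trans (fitsWord-prefix w (take k σ) X (≤-reflexive (sym lenk)))
    (trans (sym (fitsWord-prefix w (take k σ) (drop k σ) (≤-reflexive (sym lenk)))) (cong (fitsWord w) (take++drop≡id k σ))))
  (cong (fitsShape sh) (trans (cong (λ j → drop j (take k σ ++ X)) (sym lenk)) (drop-length (take k σ) X)))
  where
  k : ℕ
  k = suc (length w)
  lenk : length (take k σ) ≡ k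
  lenk = take-length k σ k≤σ

insert-shift : ∀ k p m (σ : List ℕ) → k ≤ length σ → insert (k + p) m σ ≡ take k σ ++ insert p m (drop k σ)
insert-shift zero    p m σ       _         = refl
insert-shift (suc k) p m (x ∷ σ) (s≤s k≤σ) = cong (x ∷_) (insert-shift k p m σ k≤σ)

insert-fits : ∀ m sh p (σ : List ℕ) → p < size sh → suc (length σ) ≡ size sh → All (_< m) σ →
  fitsShape sh (insert p m σ) ≡ isPeak sh p ∧ fitsShape (removePeak sh p) σ
insert-fits m (w ∷ sh) p σ p< len σ<m with p <ᵇ suc (length w) in eq
... | true  = insert-in-first-block m w sh p σ (s≤s⁻¹ (<ᵇ⇒< p (suc (length w)) (subst T (sym eq) _))) (suc-injective len) σ<m
... | false = begin
    fitsShape (w ∷ sh) (insert p m σ)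
  ≡⟨ cong (λ q → fitsShape (w ∷ sh) (insert q m σ)) (sym shift) ⟩
    fitsShape (w ∷ sh) (insert (k + p′) m σ)
  ≡⟨ cong (fitsShape (w ∷ sh)) (insert-shift k p′ m σ k≤σ) ⟩
    fitsShape (w ∷ sh) (take k σ ++ insert p′ m (drop k σ))
  ≡⟨ fits-first-block w sh σ (insert p′ m (drop k σ)) k≤σ ⟩
    fitsWord w σ ∧ fitsShape sh (insert p′ m (drop k σ))
  ≡⟨ cong (fitsWord w σ ∧_) (insert-fits m sh p′ (drop k σ) (within p<) len′ (All.drop⁺ k σ<m)) ⟩
    fitsWord w σ ∧ (isPeak sh p′ ∧ fitsShape (removePeak sh p′) (drop k σ))
  ≡⟨ ∧-swap (fitsWord w σ) (isPeak sh p′) _ ⟩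
    isPeak sh p′ ∧ (fitsWord w σ ∧ fitsShape (removePeak sh p′) (drop k σ))
  ∎
  where
  open ≡-Reasoning
  open Beyond w sh p eq
  p′ : ℕ
  p′ = p ∸ k
  lenσ : length σ ≡ length w + size sh
  lenσ = suc-injective len
  k≤σ : k ≤ length σ
  k≤σ = subst (k ≤_) (sym lenσ) (subst (_≤ length w + size sh) (+-comm (length w) 1)
          (+-monoʳ-≤ (length w) (≤-trans (s≤s z≤n) (within p<))))
  len′ : suc (length (drop k σ)) ≡ size sh
  len′ = trans (cong suc (length-drop k σ)) (trans (cong (λ l → suc (l ∸ k)) lenσ)
           (trans (sym (+-∸-assoc 1 (subst (k ≤_) lenσ k≤σ))) (m+n∸m≡n k (size sh))))

size-removePeak : ∀ sh p → p < size sh → suc (size (removePeak sh p)) ≡ size sh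
size-removePeak (w ∷ sh) p p< with p <ᵇ suc (length w) in eq
... | true = cong suc (begin
    size (leftPart (take p w) ++ rightPart (drop p w) ++ sh)
  ≡⟨ size-++ (leftPart (take p w)) (rightPart (drop p w) ++ sh) ⟩
    size (leftPart (take p w)) + size (rightPart (drop p w) ++ sh)
  ≡⟨ cong₂ _+_ (size-leftPart (take p w)) (trans (size-++ (rightPart (drop p w)) sh) (cong (_+ size sh) (size-rightPart (drop p w)))) ⟩
    length (take p w) + (length (drop p w) + size sh)
  ≡⟨ sym (+-assoc (length (take p w)) _ _) ⟩
    length (take p w) + length (drop p w) + size sh
  ≡⟨ cong (_+ size sh) (trans (sym (length-++ (take p w))) (cong length (take++drop≡id p w))) ⟩
    length w + size sh
  ∎)
  where open ≡-Reasoning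
... | false = trans (sym (+-suc k (size (removePeak sh (p ∸ k))))) (cong (k +_) (size-removePeak sh (p ∸ k) (within p<)))
  where open Beyond w sh p eq

peakTerm : Shape → ℕ → ℕ
peakTerm sh p = if isPeak sh p then shapeCount (removePeak sh p) else 0

shapeCount-rec : ∀ sh n → size sh ≡ suc n → shapeCount sh ≡ sumBelow (peakTerm sh) (suc n)
shapeCount-rec sh n size≡ = begin
    count (fitsShape sh) (Perm (size sh))
  ≡⟨ cong (λ k → count (fitsShape sh) (Perm k)) size≡ ⟩
    count (fitsShape sh) (Perm (suc n))
  ≡⟨ count-insert (fitsShape sh) n ⟩
    sum (map (λ p → count (λ σ → fitsShape sh (insert p n σ)) (Perm n)) (upTo (suc n)))
  ≡⟨ cong sum (map-cong-local (All.tabulate (λ p∈ → term _ (∈-upTo⁻ p∈)))) ⟩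
    sum (map (peakTerm sh) (upTo (suc n)))
  ≡⟨ sum-applyUpTo (peakTerm sh) (λ q → q) (suc n) ⟩
    sumBelow (peakTerm sh) (suc n)
  ∎
  where
  open ≡-Reasoning
  term : ∀ p → p < suc n → count (λ σ → fitsShape sh (insert p n σ)) (Perm n) ≡ peakTerm sh p
  term p p<1+n = trans (count-cong _ (λ σ → isPeak sh p ∧ fitsShape (removePeak sh p) σ) (Perm n)
                     (λ σ σ∈ → let (lenσ , σ<n , _) = ∈-Perm⁻ σ σ∈ in
                       insert-fits n sh p σ p<size (trans (cong suc lenσ) (sym size≡)) σ<n))
                 (trans (count-const-∧ (isPeak sh p) (fitsShape (removePeak sh p)) (Perm n)) by-peak)
    where
    p<size : p < size sh
    p<size = subst (p <_) (sym size≡) p<1+n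
    by-peak : (if isPeak sh p then count (fitsShape (removePeak sh p)) (Perm n) else 0)
            ≡ (if isPeak sh p then shapeCount (removePeak sh p) else 0)
    by-peak with isPeak sh p
    ... | true  = cong (λ k → count (fitsShape (removePeak sh p)) (Perm k))
                    (suc-injective (trans (sym size≡) (sym (size-removePeak sh p p<size))))
    ... | false = refl

-- shuffles a b : the number of interleavings of sequences of lengths a and b,
-- i.e. the binomial coefficient (a+b choose a).
shuffles : ℕ → ℕ → ℕ
shuffles zero    b       = 1
shuffles (suc a) zero    = 1
shuffles (suc a) (suc b) = shuffles a (suc b) + shuffles (suc a) b

shuffles-factorial : ∀ a b → shuffles a b *ℕ (a ! *ℕ b !) ≡ (a + b) !
shuffles-factorial zero    b       = trans (+-identityʳ _) (*-identityˡ (b !))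
shuffles-factorial (suc a) zero    = trans (+-identityʳ _) (trans (*-identityʳ _) (cong _! (sym (+-identityʳ (suc a)))))
shuffles-factorial (suc a) (suc b) = begin
    (shuffles a (suc b) + shuffles (suc a) b) *ℕ (suc a ! *ℕ suc b !)
  ≡⟨ regroup (shuffles a (suc b)) (shuffles (suc a) b) (a !) (b !) a b ⟩
    suc a *ℕ (shuffles a (suc b) *ℕ (a ! *ℕ suc b !)) + suc b *ℕ (shuffles (suc a) b *ℕ (suc a ! *ℕ b !))
  ≡⟨ cong₂ (λ x y → suc a *ℕ x + suc b *ℕ y) (shuffles-factorial a (suc b)) (shuffles-factorial (suc a) b) ⟩
    suc a *ℕ (a + suc b) ! + suc b *ℕ (suc a + b) !
  ≡⟨ cong (λ z → suc a *ℕ (a + suc b) ! + suc b *ℕ z !) (sym (+-suc a b)) ⟩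
    suc a *ℕ (a + suc b) ! + suc b *ℕ (a + suc b) !
  ≡⟨ sym (*-distribʳ-+ ((a + suc b) !) (suc a) (suc b)) ⟩
    (suc a + suc b) *ℕ (a + suc b) !
  ∎
  where
  open ≡-Reasoning
  regroup : ∀ x y fa fb a b → (x + y) *ℕ ((fa + a *ℕ fa) *ℕ (fb + b *ℕ fb))
          ≡ (1 + a) *ℕ (x *ℕ (fa *ℕ (fb + b *ℕ fb))) + (1 + b) *ℕ (y *ℕ ((fa + a *ℕ fa) *ℕ fb))
  regroup = solve-∀

peak-in-left : ∀ s₁ s₂ p → p < size s₁ →
  (isPeak (s₁ ++ s₂) p ≡ isPeak s₁ p) × (removePeak (s₁ ++ s₂) p ≡ removePeak s₁ p ++ s₂)
peak-in-left (w ∷ s₁) s₂ p p< with p <ᵇ suc (length w) in eq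
... | true  = refl , sym (trans (++-assoc (leftPart (take p w)) (rightPart (drop p w) ++ s₁) s₂)
                            (cong (leftPart (take p w) ++_) (++-assoc (rightPart (drop p w)) s₁ s₂)))
... | false with isPeak≡ , remove≡ ← peak-in-left s₁ s₂ (p ∸ suc (length w)) (Beyond.within w s₁ p eq p<) =
  isPeak≡ , cong (w ∷_) remove≡

peak-in-right : ∀ s₁ s₂ q →
  (isPeak (s₁ ++ s₂) (size s₁ + q) ≡ isPeak s₂ q) × (removePeak (s₁ ++ s₂) (size s₁ + q) ≡ s₁ ++ removePeak s₂ q)
peak-in-right []       s₂ q = refl , refl
peak-in-right (w ∷ s₁) s₂ q with suc (length w) + size s₁ + q <ᵇ suc (length w) in eq
... | true  = ⊥-elim (<-irrefl refl (≤-trans (<ᵇ⇒< (suc (length w) + size s₁ + q) (suc (length w)) (subst T (sym eq) _))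
                                            (≤-trans (m≤m+n _ (size s₁)) (m≤m+n _ q))))
... | false rewrite +-assoc (length w) (size s₁) q | m+n∸m≡n (length w) (size s₁ + q)
  with isPeak≡ , remove≡ ← peak-in-right s₁ s₂ q = isPeak≡ , cong (w ∷_) remove≡

-- Independent blocks combine by shuffling: a permutation of shape s₁ ++ s₂ is
-- an interleaving of the values of a permutation of shape s₁ and one of s₂.
shapeCount-++ : ∀ N s₁ s₂ → size s₁ + size s₂ ≡ N →
  shapeCount (s₁ ++ s₂) ≡ shuffles (size s₁) (size s₂) *ℕ shapeCount s₁ *ℕ shapeCount s₂
shapeCount-++ N       []       s₂       _ = sym (*-identityˡ (shapeCount s₂))
shapeCount-++ N       (w ∷ s₁) []       _ = trans (cong shapeCount (++-identityʳ (w ∷ s₁)))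
  (sym (trans (*-identityʳ (1 *ℕ shapeCount (w ∷ s₁))) (*-identityˡ (shapeCount (w ∷ s₁)))))
shapeCount-++ (suc N) (w ∷ s₁) (v ∷ s₂) size≡ = begin
    shapeCount (t₁ ++ t₂)
  ≡⟨ shapeCount-rec (t₁ ++ t₂) (a + suc b) (size-++ t₁ t₂) ⟩
    sumBelow (peakTerm (t₁ ++ t₂)) (suc a + suc b)
  ≡⟨ sumBelow-+ (peakTerm (t₁ ++ t₂)) (suc a) (suc b) ⟩
    sumBelow (peakTerm (t₁ ++ t₂)) (suc a) + sumBelow (λ q → peakTerm (t₁ ++ t₂) (suc a + q)) (suc b)
  ≡⟨ cong₂ _+_ (sumBelow-cong _ _ (suc a) left-terms) (sumBelow-cong _ _ (suc b) right-terms) ⟩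
    sumBelow (λ p → c₁ *ℕ peakTerm t₁ p) (suc a) + sumBelow (λ q → c₂ *ℕ peakTerm t₂ q) (suc b)
  ≡⟨ cong₂ _+_ (trans (sumBelow-* c₁ (peakTerm t₁) (suc a)) (cong (c₁ *ℕ_) (sym (shapeCount-rec t₁ a refl))))
               (trans (sumBelow-* c₂ (peakTerm t₂) (suc b)) (cong (c₂ *ℕ_) (sym (shapeCount-rec t₂ b refl)))) ⟩
    c₁ *ℕ shapeCount t₁ + c₂ *ℕ shapeCount t₂
  ≡⟨ pascal-step (shuffles a (suc b)) (shuffles (suc a) b) (shapeCount t₁) (shapeCount t₂) ⟩
    shuffles (suc a) (suc b) *ℕ shapeCount t₁ *ℕ shapeCount t₂
  ∎
  where
  open ≡-Reasoning
  t₁ t₂ : Shape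
  t₁ = w ∷ s₁
  t₂ = v ∷ s₂
  a b : ℕ
  a = length w + size s₁
  b = length v + size s₂
  c₁ c₂ : ℕ
  c₁ = shuffles a (suc b) *ℕ shapeCount t₂
  c₂ = shuffles (suc a) b *ℕ shapeCount t₁
  pascal-step : ∀ x y u v → x *ℕ v *ℕ u + y *ℕ u *ℕ v ≡ (x + y) *ℕ u *ℕ v
  pascal-step = solve-∀
  swap-last : ∀ x y z → x *ℕ y *ℕ z ≡ x *ℕ z *ℕ y
  swap-last = solve-∀
  left-terms : ∀ p → p < suc a → peakTerm (t₁ ++ t₂) p ≡ c₁ *ℕ peakTerm t₁ p
  left-terms p p< rewrite proj₁ (peak-in-left t₁ t₂ p p<) | proj₂ (peak-in-left t₁ t₂ p p<) with isPeak t₁ p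
  ... | false = sym (*-zeroʳ c₁)
  ... | true  = begin
      shapeCount (removePeak t₁ p ++ t₂)
    ≡⟨ shapeCount-++ N (removePeak t₁ p) t₂ (suc-injective (trans (cong (_+ suc b) (size-removePeak t₁ p p<)) size≡)) ⟩
      shuffles (size (removePeak t₁ p)) (suc b) *ℕ shapeCount (removePeak t₁ p) *ℕ shapeCount t₂
    ≡⟨ cong (λ z → shuffles z (suc b) *ℕ shapeCount (removePeak t₁ p) *ℕ shapeCount t₂) (suc-injective (size-removePeak t₁ p p<)) ⟩
      shuffles a (suc b) *ℕ shapeCount (removePeak t₁ p) *ℕ shapeCount t₂
    ≡⟨ swap-last (shuffles a (suc b)) (shapeCount (removePeak t₁ p)) (shapeCount t₂) ⟩
      c₁ *ℕ shapeCount (removePeak t₁ p)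
    ∎
  right-terms : ∀ q → q < suc b → peakTerm (t₁ ++ t₂) (suc a + q) ≡ c₂ *ℕ peakTerm t₂ q
  right-terms q q< rewrite proj₁ (peak-in-right t₁ t₂ q) | proj₂ (peak-in-right t₁ t₂ q) with isPeak t₂ q
  ... | false = sym (*-zeroʳ c₂)
  ... | true  = begin
      shapeCount (t₁ ++ removePeak t₂ q)
    ≡⟨ shapeCount-++ N t₁ (removePeak t₂ q)
         (suc-injective (trans (sym (+-suc (suc a) _)) (trans (cong (suc a +_) (size-removePeak t₂ q q<)) size≡))) ⟩
      shuffles (suc a) (size (removePeak t₂ q)) *ℕ shapeCount t₁ *ℕ shapeCount (removePeak t₂ q)
    ≡⟨ cong (λ z → shuffles (suc a) z *ℕ shapeCount t₁ *ℕ shapeCount (removePeak t₂ q)) (suc-injective (size-removePeak t₂ q q<)) ⟩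
      shuffles (suc a) b *ℕ shapeCount t₁ *ℕ shapeCount (removePeak t₂ q)
    ∎

word : Bool → List ℕ → Word
word u []       = []
word u (a ∷ as) = replicate a u ++ word (not u) as

length-word : ∀ u as → length (word u as) ≡ sum as
length-word u []       = refl
length-word u (a ∷ as) = trans (length-++ (replicate a u)) (cong₂ _+_ (length-replicate a) (length-word (not u) as))

fits-ascents : ∀ a w (l : List ℕ) → fitsWord (replicate a true ++ w) l ≡ increasing (take (suc a) l) ∧ fitsWord w (drop a l)
fits-ascents zero    w []          = refl
fits-ascents zero    w (x ∷ l)     = refl
fits-ascents (suc a) w []          = sym (fitsWord-[] w)
fits-ascents (suc a) w (x ∷ [])    = sym (trans (cong (fitsWord w) (drop-[] a)) (fitsWord-[] w))
fits-ascents (suc a) w (x ∷ y ∷ l) = trans (cong ((x <ᵇ y) ∧_) (fits-ascents a w (y ∷ l))) (sym (∧-assoc (x <ᵇ y) _ _))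

fits-descents : ∀ a w (l : List ℕ) → fitsWord (replicate a false ++ w) l ≡ decreasing (take (suc a) l) ∧ fitsWord w (drop a l)
fits-descents zero    w []          = refl
fits-descents zero    w (x ∷ l)     = refl
fits-descents (suc a) w []          = sym (fitsWord-[] w)
fits-descents (suc a) w (x ∷ [])    = sym (trans (cong (fitsWord w) (drop-[] a)) (fitsWord-[] w))
fits-descents (suc a) w (x ∷ y ∷ l) = trans (cong ((y <ᵇ x) ∧_) (fits-descents a w (y ∷ l))) (sym (∧-assoc (y <ᵇ x) _ _))

fits≡fitsWord : ∀ u as (l : List ℕ) → fits u as l ≡ fitsWord (word u as) l
fits≡fitsWord u     []       l = refl
fits≡fitsWord true  (a ∷ as) l = trans (cong (increasing (take (suc a) l) ∧_) (fits≡fitsWord false as (drop a l)))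
                                       (sym (fits-ascents a (word false as) l))
fits≡fitsWord false (a ∷ as) l = trans (cong (decreasing (take (suc a) l) ∧_) (fits≡fitsWord true as (drop a l)))
                                       (sym (fits-descents a (word true as) l))

size-word : ∀ u as → size (word u as ∷ []) ≡ suc (sum as)
size-word u as = cong suc (trans (+-identityʳ _) (length-word u as))

Ω≡shapeCount : ∀ as → Ω as ≡ shapeCount (word true as ∷ [])
Ω≡shapeCount as = trans
  (count-cong (fits true as) (fitsShape (word true as ∷ [])) (Perm (suc (sum as)))
              (λ l _ → trans (fits≡fitsWord true as l) (sym (∧-identityʳ _))))
  (cong (λ k → count (fitsShape (word true as ∷ [])) (Perm k)) (sym (size-word true as)))

step-complement : ∀ n b x y → x < n → y < n → step (not b) (complement n x) (complement n y) ≡ step b x y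
step-complement n true  x y x<n y<n = reverse-< x y x<n y<n
  where
  reverse-< : ∀ x y → x < n → y < n → (complement n y <ᵇ complement n x) ≡ (x <ᵇ y)
  reverse-< x y x<n y<n with x <ᵇ y in eq
  ... | true  = <ᵇ-true (∸-monoʳ-< (s≤s (<ᵇ⇒< x y (subst T (sym eq) _))) y<n)
  ... | false = <ᵇ-false (∸-monoʳ-≤ n (s≤s (≮⇒≥ (λ x<y → subst T eq (<⇒<ᵇ x<y)))))
step-complement n false x y x<n y<n = step-complement n true y x y<n x<n

fitsWord-complement : ∀ n w (l : List ℕ) → All (_< n) l → fitsWord (map not w) (map (complement n) l) ≡ fitsWord w l
fitsWord-complement n []      l           _                 = refl
fitsWord-complement n (b ∷ w) []          _                 = refl
fitsWord-complement n (b ∷ w) (x ∷ [])    _                 = refl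
fitsWord-complement n (b ∷ w) (x ∷ y ∷ l) (x<n ∷ y<n ∷ l<n) =
  cong₂ _∧_ (step-complement n b x y x<n y<n) (fitsWord-complement n w (y ∷ l) (y<n ∷ l<n))

map-not-word : ∀ u as → map not (word u as) ≡ word (not u) as
map-not-word u []       = refl
map-not-word u (a ∷ as) = trans (map-++ not (replicate a u) (word (not u) as))
  (cong₂ _++_ (map-replicate not a u) (map-not-word (not u) as))

shapeCount-flip : ∀ w → shapeCount (map not w ∷ []) ≡ shapeCount (w ∷ [])
shapeCount-flip w = begin
    count (fitsShape (map not w ∷ [])) (Perm (suc (length (map not w)) + 0))
  ≡⟨ cong (λ k → count (fitsShape (map not w ∷ [])) (Perm (suc k + 0))) (length-map not w) ⟩
    count (fitsShape (map not w ∷ [])) (Perm n)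
  ≡⟨ count-complement (fitsShape (map not w ∷ [])) n ⟩
    count (λ l → fitsShape (map not w ∷ []) (map (complement n) l)) (Perm n)
  ≡⟨ count-cong _ _ (Perm n) (λ l l∈ → cong (_∧ true) (fitsWord-complement n w l (proj₁ (proj₂ (∈-Perm⁻ l l∈))))) ⟩
    count (fitsShape (w ∷ [])) (Perm n)
  ∎
  where
  open ≡-Reasoning
  n : ℕ
  n = suc (length w) + 0

Ω≡shapeCount-down : ∀ as → Ω as ≡ shapeCount (word false as ∷ [])
Ω≡shapeCount-down as = trans (Ω≡shapeCount as)
  (trans (sym (shapeCount-flip (word true as))) (cong (λ w → shapeCount (w ∷ [])) (map-not-word true as)))

-- splitSum F w = Σ_{p ≤ |w|} F (take p w) (drop p w): a sum over the ways of
-- cutting w in two, computed by moving the cut from left to right.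
splitSum : (Word → Word → ℕ) → Word → ℕ
splitSum F []      = F [] []
splitSum F (b ∷ w) = F [] (b ∷ w) + splitSum (λ l r → F (b ∷ l) r) w

splitSum-sumBelow : ∀ F w → splitSum F w ≡ sumBelow (λ p → F (take p w) (drop p w)) (suc (length w))
splitSum-sumBelow F []      = sym (+-identityʳ _)
splitSum-sumBelow F (b ∷ w) = cong (F [] (b ∷ w) +_) (splitSum-sumBelow (λ l r → F (b ∷ l) r) w)

peakSplit : Word → Word → ℕ
peakSplit l r = if peak l r then shapeCount (leftPart l ++ rightPart r ++ []) else 0

shapeCount-one-block : ∀ w → shapeCount (w ∷ []) ≡ splitSum peakSplit w
shapeCount-one-block w = trans (shapeCount-rec (w ∷ []) (length w + 0) refl)
  (trans (sumBelow-cong _ (λ p → peakSplit (take p w) (drop p w)) (suc (length w + 0)) cut-term)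
    (trans (cong (sumBelow (λ p → peakSplit (take p w) (drop p w))) (cong suc (+-identityʳ (length w))))
      (sym (splitSum-sumBelow peakSplit w))))
  where
  cut-term : ∀ p → p < suc (length w + 0) → peakTerm (w ∷ []) p ≡ peakSplit (take p w) (drop p w)
  cut-term p p< with p <ᵇ suc (length w) in eq
  ... | true  = refl
  ... | false = ⊥-elim (subst T eq (<⇒<ᵇ (subst (p <_) (cong suc (+-identityʳ (length w))) p<)))

record PeakLike (F : Word → Word → ℕ) : Set where
  field
    before-ascent : ∀ l r → F l (true ∷ r) ≡ 0
    after-descent : ∀ l r → F (l ++ false ∷ []) r ≡ 0
open PeakLike

endsUp-++ : ∀ X c w → endsUp (X ++ c ∷ w) ≡ endsUp (c ∷ w)
endsUp-++ []          c w = refl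
endsUp-++ (x ∷ [])    c w = refl
endsUp-++ (x ∷ y ∷ X) c w = endsUp-++ (y ∷ X) c w

peakSplit-PeakLike : PeakLike peakSplit
peakSplit-PeakLike .before-ascent l r rewrite ∧-zeroʳ (endsUp l) = refl
peakSplit-PeakLike .after-descent l r rewrite endsUp-++ l false [] = refl

PeakLike-shift : ∀ {F} → PeakLike F → ∀ A → PeakLike (λ l r → F (A ++ l) r)
PeakLike-shift     pl []      = pl
PeakLike-shift {F} pl (c ∷ A) = PeakLike-shift shifted A
  where
  shifted : PeakLike (λ l r → F (c ∷ l) r)
  shifted .before-ascent l r = pl .before-ascent (c ∷ l) r
  shifted .after-descent l r = pl .after-descent (c ∷ l) r

inside-run : ∀ {F} → PeakLike F → ∀ c r → F (c ∷ []) (c ∷ r) ≡ 0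
inside-run pl true  r = pl .before-ascent (true ∷ []) r
inside-run pl false r = pl .after-descent [] (false ∷ r)

splitSum-run : ∀ {F} → PeakLike F → ∀ c i R →
  splitSum F (c ∷ replicate i c ++ R) ≡ F [] (c ∷ replicate i c ++ R) + splitSum (λ l r → F (c ∷ replicate i c ++ l) r) R
splitSum-run pl c zero    R = refl
splitSum-run {F} pl c (suc i) R = cong (F [] (c ∷ c ∷ replicate i c ++ R) +_) (begin
    splitSum F₁ (c ∷ replicate i c ++ R)
  ≡⟨ splitSum-run (PeakLike-shift pl (c ∷ [])) c i R ⟩
    F₁ [] (c ∷ replicate i c ++ R) + splitSum (λ l r → F₁ (c ∷ replicate i c ++ l) r) R
  ≡⟨ cong (_+ splitSum (λ l r → F₁ (c ∷ replicate i c ++ l) r) R) (inside-run pl c (replicate i c ++ R)) ⟩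
    splitSum (λ l r → F₁ (c ∷ replicate i c ++ l) r) R
  ∎)
  where
  open ≡-Reasoning
  F₁ : Word → Word → ℕ
  F₁ l r = F (c ∷ l) r

splitSum-runs : ∀ {F} → PeakLike F → ∀ u i j R →
  splitSum F (replicate (suc i) u ++ replicate (suc j) (not u) ++ R)
  ≡ F [] (replicate (suc i) u ++ replicate (suc j) (not u) ++ R)
    + (F (replicate (suc i) u) (replicate (suc j) (not u) ++ R)
       + splitSum (λ l r → F (replicate (suc i) u ++ (replicate (suc j) (not u) ++ l)) r) R)
splitSum-runs {F} pl u i j R =
  trans (splitSum-run pl u i (replicate (suc j) (not u) ++ R))
        (cong (F [] (replicate (suc i) u ++ replicate (suc j) (not u) ++ R) +_)
              (trans (splitSum-run (PeakLike-shift pl (replicate (suc i) u)) (not u) j R)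
                     (cong (λ l → F l (replicate (suc j) (not u) ++ R)
                                  + splitSum (λ l′ r → F (replicate (suc i) u ++ (replicate (suc j) (not u) ++ l′)) r) R)
                           (++-identityʳ (replicate (suc i) u)))))

AllPositive : List (ℕ × ℕ) → Set
AllPositive = All (λ p → 1 ≤ proj₁ p × 1 ≤ proj₂ p)

wordThen : Bool → List ℕ → Word → Word
wordThen u []       l = l
wordThen u (a ∷ as) l = replicate a u ++ wordThen (not u) as l

-- The cut at the top of the k-th ascending run of word true (flat ps).
upCut : (Word → Word → ℕ) → List (ℕ × ℕ) → ℕ → ℕ
upCut F ps k = F (wordThen true (flat (take k ps)) (replicate (proj₁ (pairAt ps k)) true))
                 (replicate (proj₂ (pairAt ps k)) false ++ word true (flat (drop (suc k) ps)))

-- In word true (flat ps) = ↑^i₁ ↓^j₁ … ↑^iₙ ↓^jₙ the candidate peaks are the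
-- tops of the ascending runs and the very end.
splitSum-up : ∀ {F} → PeakLike F → ∀ ps → AllPositive ps →
  splitSum F (word true (flat ps)) ≡ sumBelow (upCut F ps) (length ps) + F (word true (flat ps)) []
splitSum-up pl [] [] = refl
splitSum-up {F} pl ((suc i , suc j) ∷ ps) (_ ∷ ps-pos) = begin
    splitSum F (replicate (suc i) true ++ replicate (suc j) false ++ R)
  ≡⟨ splitSum-runs pl true i j R ⟩
    F [] (replicate (suc i) true ++ replicate (suc j) false ++ R) + (top + splitSum F′ R)
  ≡⟨ cong (_+ (top + splitSum F′ R)) (pl .before-ascent [] _) ⟩
    top + splitSum F′ R
  ≡⟨ cong (top +_) (splitSum-up (PeakLike-shift (PeakLike-shift pl (replicate (suc i) true)) (replicate (suc j) false)) ps ps-pos) ⟩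
    top + (sumBelow (upCut F′ ps) (length ps) + F′ R [])
  ≡⟨ sym (+-assoc top _ _) ⟩
    top + sumBelow (upCut F′ ps) (length ps) + F′ R []
  ∎
  where
  open ≡-Reasoning
  R : Word
  R = word true (flat ps)
  top : ℕ
  top = F (replicate (suc i) true) (replicate (suc j) false ++ R)
  F′ : Word → Word → ℕ
  F′ l r = F (replicate (suc i) true ++ (replicate (suc j) false ++ l)) r

after-descents : ∀ {F} → PeakLike F → ∀ j r → F (false ∷ replicate j false) r ≡ 0
after-descents pl zero    r = pl .after-descent [] r
after-descents pl (suc j) r = after-descents (PeakLike-shift pl (false ∷ [])) j r

-- word true (flat ps) ends with a descent, so its end is no peak.
end-of-up-word : ∀ {F} → PeakLike F → ∀ p ps → AllPositive (p ∷ ps) → F (word true (flat (p ∷ ps))) [] ≡ 0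
end-of-up-word {F} pl (suc i , suc j) [] _ =
  trans (cong (λ l → F (replicate (suc i) true ++ l) []) (++-identityʳ (replicate (suc j) false)))
        (after-descents (PeakLike-shift pl (replicate (suc i) true)) j [])
end-of-up-word pl (i , j) (q ∷ ps) (_ ∷ ps-pos) =
  end-of-up-word (PeakLike-shift (PeakLike-shift pl (replicate i true)) (replicate j false)) q ps ps-pos

downCut : (Word → Word → ℕ) → List (ℕ × ℕ) → ℕ → ℕ
downCut F ps k = F (word false (flat (take k ps))) (word false (flat (drop k ps)))

-- In word false (flat ps) = ↓^i₁ ↑^j₁ … ↓^iₙ ↑^jₙ the candidate peaks are the
-- n+1 cuts between consecutive pairs (including both ends).
splitSum-down : ∀ {F} → PeakLike F → ∀ ps → AllPositive ps →
  splitSum F (word false (flat ps)) ≡ sumBelow (downCut F ps) (suc (length ps))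
splitSum-down pl [] [] = sym (+-identityʳ _)
splitSum-down {F} pl ((suc i , suc j) ∷ ps) (_ ∷ ps-pos) = begin
    splitSum F (replicate (suc i) false ++ replicate (suc j) true ++ R)
  ≡⟨ splitSum-runs pl false i j R ⟩
    start + (F (replicate (suc i) false) (replicate (suc j) true ++ R) + splitSum F′ R)
  ≡⟨ cong (λ x → start + (x + splitSum F′ R)) (pl .before-ascent (replicate (suc i) false) _) ⟩
    start + splitSum F′ R
  ≡⟨ cong (start +_) (splitSum-down (PeakLike-shift (PeakLike-shift pl (replicate (suc i) false)) (replicate (suc j) true)) ps ps-pos) ⟩
    start + sumBelow (downCut F′ ps) (suc (length ps))
  ∎
  where
  open ≡-Reasoning
  R : Word
  R = word false (flat ps)
  start : ℕ
  start = F [] (replicate (suc i) false ++ replicate (suc j) true ++ R)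
  F′ : Word → Word → ℕ
  F′ l r = F (replicate (suc i) false ++ (replicate (suc j) true ++ l)) r

wordThen-++ : ∀ u xs l → wordThen u xs l ≡ wordThen u xs [] ++ l
wordThen-++ u []       l = refl
wordThen-++ u (a ∷ xs) l = trans (cong (replicate a u ++_) (wordThen-++ (not u) xs l)) (sym (++-assoc (replicate a u) _ l))

length-wordThen : ∀ u xs l → length (wordThen u xs l) ≡ sum xs + length l
length-wordThen u []       l = refl
length-wordThen u (a ∷ xs) l = trans (length-++ (replicate a u))
  (trans (cong₂ _+_ (length-replicate a) (length-wordThen (not u) xs l)) (sym (+-assoc a (sum xs) (length l))))

word-up-snoc : ∀ A i → word true (flat A ++ i ∷ []) ≡ wordThen true (flat A) (replicate i true)
word-up-snoc []            i = ++-identityʳ (replicate i true)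
word-up-snoc ((a , b) ∷ A) i = cong (λ z → replicate a true ++ (replicate b false ++ z)) (word-up-snoc A i)

endsUp-run : ∀ c i → endsUp (c ∷ replicate i c) ≡ c
endsUp-run c zero    = refl
endsUp-run c (suc i) = endsUp-run c i

leftPart-++ : ∀ X Y W → leftPart Y ≡ W ∷ [] → leftPart (X ++ Y) ≡ (X ++ W) ∷ []
leftPart-++ []      Y       W eq = eq
leftPart-++ (x ∷ X) (y ∷ Y) W eq = cong (_∷ []) (trans (init-++ x X y Y) (cong (λ z → x ∷ (X ++ z)) (∷-injectiveˡ eq)))
  where
  init-++ : ∀ x X y Y → init x (X ++ y ∷ Y) ≡ x ∷ (X ++ init y Y)
  init-++ x []       y Y = refl
  init-++ x (x′ ∷ X) y Y = cong (x ∷_) (init-++ x′ X y Y)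

init-run : ∀ c i → init c (replicate i c) ≡ replicate i c
init-run c zero    = refl
init-run c (suc i) = cong (c ∷_) (init-run c i)

peakSplit-at-peak : ∀ l r → peak l r ≡ true → peakSplit l r ≡ shapeCount (leftPart l ++ rightPart r)
peakSplit-at-peak l r is-peak rewrite is-peak = cong (λ sh → shapeCount (leftPart l ++ sh)) (++-identityʳ (rightPart r))

length-at-top : ∀ xs ys i j →
  length (wordThen true xs (replicate i true)) + length (replicate j false ++ word true ys) ≡ sum xs + (i + (j + sum ys))
length-at-top xs ys i j = begin
    length (wordThen true xs (replicate i true)) + length (replicate j false ++ word true ys)
  ≡⟨ cong₂ _+_ (trans (length-wordThen true xs _) (cong (sum xs +_) (length-replicate i)))
               (trans (length-++ (replicate j false)) (cong₂ _+_ (length-replicate j) (length-word true ys))) ⟩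
    (sum xs + i) + (j + sum ys)
  ≡⟨ +-assoc (sum xs) i _ ⟩
    sum xs + (i + (j + sum ys))
  ∎
  where open ≡-Reasoning

pairAt-positive : ∀ ps k → AllPositive ps → k < length ps → 1 ≤ proj₁ (pairAt ps k) × 1 ≤ proj₂ (pairAt ps k)
pairAt-positive (p ∷ ps) zero    (p-pos ∷ _)  _         = p-pos
pairAt-positive (p ∷ ps) (suc k) (_ ∷ ps-pos) (s≤s k<n) = pairAt-positive ps k ps-pos k<n

sum-at-pair : ∀ ps k → k < length ps →
  sum (flat (take k ps)) + (proj₁ (pairAt ps k) + (proj₂ (pairAt ps k) + sum (flat (drop (suc k) ps)))) ≡ sum (flat ps)
sum-at-pair ((i , j) ∷ ps) zero    _         = refl
sum-at-pair ((i , j) ∷ ps) (suc k) (s≤s k<n) =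
  trans (+-assoc i _ _) (cong (i +_) (trans (+-assoc j _ _) (cong (j +_) (sum-at-pair ps k k<n))))

flat-++ : ∀ A C → flat (A ++ C) ≡ flat A ++ flat C
flat-++ []            C = refl
flat-++ ((i , j) ∷ A) C = cong (λ z → i ∷ j ∷ z) (flat-++ A C)

endsUp-down : ∀ A → AllPositive A → endsUp (word false (flat A)) ≡ true
endsUp-down []                               []                  = refl
endsUp-down ((i , suc j) ∷ [])               _                   =
  trans (endsUp-++ (replicate i false) true _) (trans (cong (λ w → endsUp (true ∷ w)) (++-identityʳ (replicate j true))) (endsUp-run true j))
endsUp-down ((i , zero) ∷ _)                 ((_ , ()) ∷ _)
endsUp-down ((i , suc j) ∷ (zero , j′) ∷ A)  (_ ∷ (() , _) ∷ _)
endsUp-down ((i , suc j) ∷ (suc i′ , j′) ∷ A) (_ ∷ q-pos ∷ A-pos) =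
  trans (endsUp-++ (replicate i false) true _)
    (trans (endsUp-++ (true ∷ replicate j true) false _) (endsUp-down ((suc i′ , j′) ∷ A) (q-pos ∷ A-pos)))

startsDown-down : ∀ C → AllPositive C → startsDown (word false (flat C)) ≡ true
startsDown-down []                  []      = refl
startsDown-down ((zero , j) ∷ C)    ((() , _) ∷ _)
startsDown-down ((suc i , j) ∷ C)   _       = refl

leftPart-down : ∀ p A → AllPositive (p ∷ A) → leftPart (word false (flat (p ∷ A))) ≡ word false (decLast (flat (p ∷ A))) ∷ []
leftPart-down (i , suc j) []      _             =
  leftPart-++ (replicate i false) (true ∷ replicate j true ++ []) (replicate j true ++ [])
    (cong (_∷ []) (trans (cong (init true) (++-identityʳ (replicate j true)))
                         (trans (init-run true j) (sym (++-identityʳ (replicate j true))))))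
leftPart-down (i , j)     (q ∷ A) (_ ∷ q-pos ∷ A-pos) =
  leftPart-++ (replicate i false) _ _ (leftPart-++ (replicate j true) _ _ (leftPart-down q A (q-pos ∷ A-pos)))

Ω-up-cuts : ∀ ps → 1 ≤ length ps → AllPositive ps → Ω (flat ps) ≡ sumBelow (upCut peakSplit ps) (length ps)
Ω-up-cuts (p ∷ ps) _ ps-pos = begin
    Ω (flat (p ∷ ps))
  ≡⟨ Ω≡shapeCount (flat (p ∷ ps)) ⟩
    shapeCount (word true (flat (p ∷ ps)) ∷ [])
  ≡⟨ shapeCount-one-block (word true (flat (p ∷ ps))) ⟩
    splitSum peakSplit (word true (flat (p ∷ ps)))
  ≡⟨ splitSum-up peakSplit-PeakLike (p ∷ ps) ps-pos ⟩
    sumBelow (upCut peakSplit (p ∷ ps)) (length (p ∷ ps)) + peakSplit (word true (flat (p ∷ ps))) []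
  ≡⟨ cong (sumBelow (upCut peakSplit (p ∷ ps)) (length (p ∷ ps)) +_) (end-of-up-word peakSplit-PeakLike p ps ps-pos) ⟩
    sumBelow (upCut peakSplit (p ∷ ps)) (length (p ∷ ps)) + 0
  ≡⟨ +-identityʳ _ ⟩
    sumBelow (upCut peakSplit (p ∷ ps)) (length (p ∷ ps))
  ∎
  where open ≡-Reasoning

Ω-down-cuts : ∀ ps → AllPositive ps → Ω (flat ps) ≡ sumBelow (downCut peakSplit ps) (suc (length ps))
Ω-down-cuts ps ps-pos = trans (Ω≡shapeCount-down (flat ps))
  (trans (shapeCount-one-block (word false (flat ps))) (splitSum-down peakSplit-PeakLike ps ps-pos))

-- The passage to rationals.  (From here on, _+_ is on ℕ and +_ embeds ℕ in ℤ.)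
open import Data.Integer using (ℤ; +_) renaming (_+_ to _+ℤ_; _*_ to _*ℤ_)
open import Data.Integer.Properties using (pos-*; pos-+)
import Data.Integer.Tactic.RingSolver as ℤ-Solver
open import Data.Rational using (ℚ; _/_; _*_; 0ℚ; fromℚᵘ; toℚᵘ) renaming (_+_ to _+ℚ_)
open import Data.Rational.Properties using (fromℚᵘ-cong; fromℚᵘ-toℚᵘ; toℚᵘ-fromℚᵘ; toℚᵘ-homo-+; toℚᵘ-homo-*; /-cong; 0/n≡0)
import Data.Rational.Unnormalised as ℚᵘ
import Data.Rational.Unnormalised.Properties as ℚᵘ

-- Arithmetic of fractions of naturals, checked on unnormalised representatives.
/-cross : ∀ a b d e .{{_ : NonZero d}} .{{_ : NonZero e}} → a *ℕ e ≡ b *ℕ d → (+ a) / d ≡ (+ b) / e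
/-cross a b (suc d) (suc e) eq = fromℚᵘ-cong {ℚᵘ.mkℚᵘ (+ a) d} {ℚᵘ.mkℚᵘ (+ b) e}
  (ℚᵘ.*≡* (trans (sym (pos-* a (suc e))) (trans (cong +_ eq) (pos-* b (suc d)))))

/-* : ∀ a b d e .{{_ : NonZero d}} .{{_ : NonZero e}} →
  ((+ a) / d) * ((+ b) / e) ≡ _/_ (+ (a *ℕ b)) (d *ℕ e) {{m*n≢0 d e}}
/-* a b (suc d) (suc e) = trans (sym (fromℚᵘ-toℚᵘ _))
  (fromℚᵘ-cong {_} {ℚᵘ._/_ (+ (a *ℕ b)) (suc d *ℕ suc e)} (ℚᵘ.≃-trans
    (ℚᵘ.≃-trans (toℚᵘ-homo-* ((+ a) / suc d) ((+ b) / suc e))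
                (ℚᵘ.*-cong (toℚᵘ-fromℚᵘ (ℚᵘ.mkℚᵘ (+ a) d)) (toℚᵘ-fromℚᵘ (ℚᵘ.mkℚᵘ (+ b) e))))
    (ℚᵘ.*≡* (cong (_*ℤ (+ (suc d *ℕ suc e))) (sym (pos-* a b))))))

/-+ : ∀ a b d .{{_ : NonZero d}} → ((+ a) / d) +ℚ ((+ b) / d) ≡ (+ (a + b)) / d
/-+ a b (suc d) = trans (sym (fromℚᵘ-toℚᵘ _))
  (fromℚᵘ-cong {_} {ℚᵘ.mkℚᵘ (+ (a + b)) d} (ℚᵘ.≃-trans
    (ℚᵘ.≃-trans (toℚᵘ-homo-+ ((+ a) / suc d) ((+ b) / suc d))
                (ℚᵘ.+-cong (toℚᵘ-fromℚᵘ (ℚᵘ.mkℚᵘ (+ a) d)) (toℚᵘ-fromℚᵘ (ℚᵘ.mkℚᵘ (+ b) d))))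
    (ℚᵘ.*≡* (trans (common-denominator (+ a) (+ b) (+ suc d)) (cong₂ _*ℤ_ (sym (pos-+ a b)) (sym (pos-* (suc d) (suc d))))))))
  where
  common-denominator : ∀ (x y d : ℤ) → (x *ℤ d +ℤ y *ℤ d) *ℤ d ≡ (x +ℤ y) *ℤ (d *ℤ d)
  common-denominator = ℤ-Solver.solve-∀

_/!_ : ℕ → ℕ → ℚ
a /! n = _/_ (+ a) (n !) {{n !≢0}}

/!-cong : ∀ {a b m n} → a ≡ b → m ≡ n → a /! m ≡ b /! n
/!-cong refl refl = refl

/!-* : ∀ a b m n → (a /! m) * (b /! n) ≡ (shuffles m n *ℕ a *ℕ b) /! (m + n)
/!-* a b m n = trans (/-* a b (m !) (n !) {{m !≢0}} {{n !≢0}})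
  (/-cross (a *ℕ b) (shuffles m n *ℕ a *ℕ b) (m ! *ℕ n !) ((m + n) !) {{m*n≢0 (m !) (n !) {{m !≢0}} {{n !≢0}}}} {{(m + n) !≢0}} cross)
  where
  rearrange : ∀ x y c f g → x *ℕ y *ℕ (c *ℕ (f *ℕ g)) ≡ c *ℕ x *ℕ y *ℕ (f *ℕ g)
  rearrange = solve-∀
  cross : a *ℕ b *ℕ (m + n) ! ≡ shuffles m n *ℕ a *ℕ b *ℕ (m ! *ℕ n !)
  cross = trans (cong (a *ℕ b *ℕ_) (sym (shuffles-factorial m n))) (rearrange a b (shuffles m n) (m !) (n !))

/!-suc : ∀ a N → a /! suc N ≡ ((+ 1) / suc N) * (a /! N)
/!-suc a N = sym (trans (/-* 1 a (suc N) (N !) {{_}} {{N !≢0}})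
  (/-cong {{m*n≢0 (suc N) (N !) {{_}} {{N !≢0}}}} {{suc N !≢0}} (cong +_ (*-identityˡ a)) refl))

sumℚ-/! : ∀ (g : ℕ → ℚ) (h : ℕ → ℕ) n N → (∀ k → k < n → g k ≡ h k /! N) → sumℚ (map g (upTo n)) ≡ sumBelow h n /! N
sumℚ-/! g h n N eq = sumℚ-applyUpTo g (λ k → k) h n eq
  where
  sumℚ-applyUpTo : ∀ (g : ℕ → ℚ) (f h : ℕ → ℕ) n → (∀ k → k < n → g (f k) ≡ h k /! N) →
    sumℚ (map g (applyUpTo f n)) ≡ sumBelow h n /! N
  sumℚ-applyUpTo g f h zero    eq = sym (0/n≡0 (N !) {{N !≢0}})
  sumℚ-applyUpTo g f h (suc n) eq = trans
    (cong₂ _+ℚ_ (eq 0 (s≤s z≤n)) (sumℚ-applyUpTo g (λ k → f (suc k)) (λ k → h (suc k)) n (λ k k<n → eq (suc k) (s≤s k<n))))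
    (/-+ (h 0) (sumBelow (λ k → h (suc k)) n) (N !) {{N !≢0}})

Ω'-up : ∀ X → Ω' X ≡ shapeCount (word true X ∷ []) /! size (word true X ∷ [])
Ω'-up X = /!-cong (Ω≡shapeCount X) (sym (size-word true X))

Ω'-down : ∀ X → Ω' X ≡ shapeCount (word false X ∷ []) /! size (word false X ∷ [])
Ω'-down X = /!-cong (Ω≡shapeCount-down X) (sym (size-word false X))

cut-product : ∀ X Y l r N → peak l r ≡ true →
  Ω' X ≡ shapeCount (leftPart l) /! size (leftPart l) → Ω' Y ≡ shapeCount (rightPart r) /! size (rightPart r) →
  length l + length r ≡ N → Ω' X * Ω' Y ≡ peakSplit l r /! N
cut-product X Y l r N is-peak Ωˡ Ωʳ len =
  trans (cong₂ _*_ Ωˡ Ωʳ)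
  (trans (/!-* (shapeCount (leftPart l)) (shapeCount (rightPart r)) (size (leftPart l)) (size (rightPart r)))
  (/!-cong (sym (trans (peakSplit-at-peak l r is-peak) (shapeCount-++ _ (leftPart l) (rightPart r) refl))) sizes))
  where
  sizes : size (leftPart l) + size (rightPart r) ≡ N
  sizes = trans (cong₂ _+_ (size-leftPart l) (size-rightPart r)) len

top-of-run : ∀ A C i j N → sum (flat A) + (suc i + (suc j + sum (flat C))) ≡ N →
  Ω' (flat A ++ i ∷ []) * Ω' (j ∷ flat C)
  ≡ peakSplit (wordThen true (flat A) (replicate (suc i) true)) (replicate (suc j) false ++ word true (flat C)) /! N
top-of-run A C i j N total = cut-product (flat A ++ i ∷ []) (j ∷ flat C) L R N is-peak Ωˡ (Ω'-down (j ∷ flat C)) len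
  where
  X L R : Word
  X = wordThen true (flat A) []
  L = wordThen true (flat A) (replicate (suc i) true)
  R = replicate (suc j) false ++ word true (flat C)
  is-peak : peak L R ≡ true
  is-peak = cong (_∧ true) (trans (cong endsUp (wordThen-++ true (flat A) _)) (trans (endsUp-++ X true _) (endsUp-run true i)))
  left : leftPart L ≡ word true (flat A ++ i ∷ []) ∷ []
  left = trans (cong leftPart (wordThen-++ true (flat A) _))
        (trans (leftPart-++ X (true ∷ replicate i true) _ refl)
        (trans (cong (λ w → (X ++ w) ∷ []) (init-run true i))
               (cong (_∷ []) (sym (trans (word-up-snoc A i) (wordThen-++ true (flat A) _))))))
  Ωˡ : Ω' (flat A ++ i ∷ []) ≡ shapeCount (leftPart L) /! size (leftPart L)
  Ωˡ = trans (Ω'-up (flat A ++ i ∷ [])) (cong (λ sh → shapeCount sh /! size sh) (sym left))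
  len : length L + length R ≡ N
  len = trans (length-at-top (flat A) (flat C) (suc i) (suc j)) total

up-cut-term : ∀ ps k → AllPositive ps → k < length ps →
  Ω' (flat (take k ps) ++ (proj₁ (pairAt ps k) ∸ 1) ∷ []) * Ω' ((proj₂ (pairAt ps k) ∸ 1) ∷ flat (drop (suc k) ps))
  ≡ upCut peakSplit ps k /! sum (flat ps)
up-cut-term ps k ps-pos k<n = at-pair (pairAt ps k) (pairAt-positive ps k ps-pos k<n) (sum-at-pair ps k k<n)
  where
  A C : List (ℕ × ℕ)
  A = take k ps
  C = drop (suc k) ps
  at-pair : ∀ q → 1 ≤ proj₁ q × 1 ≤ proj₂ q → sum (flat A) + (proj₁ q + (proj₂ q + sum (flat C))) ≡ sum (flat ps) →
    Ω' (flat A ++ (proj₁ q ∸ 1) ∷ []) * Ω' ((proj₂ q ∸ 1) ∷ flat C)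
    ≡ peakSplit (wordThen true (flat A) (replicate (proj₁ q) true)) (replicate (proj₂ q) false ++ word true (flat C)) /! sum (flat ps)
  at-pair (suc i , suc j) (s≤s z≤n , s≤s z≤n) total = top-of-run A C i j (sum (flat ps)) total

down-cut-term : ∀ ps k → AllPositive ps →
  Ω' (decLast (flat (take k ps))) * Ω' (decHead (flat (drop k ps))) ≡ downCut peakSplit ps k /! sum (flat ps)
down-cut-term ps k ps-pos =
  cut-product (decLast (flat A)) (decHead (flat C)) L R (sum (flat ps)) is-peak (Ωˡ A A-pos) (Ωʳ C C-pos) len
  where
  A C : List (ℕ × ℕ)
  A = take k ps
  C = drop k ps
  A-pos : AllPositive A
  A-pos = All.take⁺ k ps-pos
  C-pos : AllPositive C
  C-pos = All.drop⁺ k ps-pos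
  L R : Word
  L = word false (flat A)
  R = word false (flat C)
  is-peak : peak L R ≡ true
  is-peak = cong₂ _∧_ (endsUp-down A A-pos) (startsDown-down C C-pos)
  Ωˡ : ∀ A → AllPositive A → Ω' (decLast (flat A)) ≡ shapeCount (leftPart (word false (flat A))) /! size (leftPart (word false (flat A)))
  Ωˡ []      _     = refl
  Ωˡ (p ∷ A) A-pos = trans (Ω'-down (decLast (flat (p ∷ A))))
    (cong (λ sh → shapeCount sh /! size sh) (sym (leftPart-down p A A-pos)))
  Ωʳ : ∀ C → AllPositive C → Ω' (decHead (flat C)) ≡ shapeCount (rightPart (word false (flat C))) /! size (rightPart (word false (flat C)))
  Ωʳ []                _ = refl
  Ωʳ ((zero , j) ∷ C)  ((() , _) ∷ _)
  Ωʳ ((suc i , j) ∷ C) _ = Ω'-down (i ∷ j ∷ flat C)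
  len : length L + length R ≡ sum (flat ps)
  len = trans (cong₂ _+_ (length-word false (flat A)) (length-word false (flat C)))
          (trans (sym (sum-++ (flat A) (flat C))) (cong sum (trans (sym (flat-++ A C)) (cong flat (take++drop≡id k ps)))))

Ω'-as-sum : ∀ as (g : ℕ → ℚ) h m → Ω as ≡ sumBelow h m → (∀ k → k < m → g k ≡ h k /! sum as) →
  Ω' as ≡ ((+ 1) / suc (sum as)) * sumℚ (map g (upTo m))
Ω'-as-sum as g h m Ω≡ terms = begin
    Ω' as
  ≡⟨ /!-suc (Ω as) (sum as) ⟩
    ((+ 1) / suc (sum as)) * (Ω as /! sum as)
  ≡⟨ cong (λ c → ((+ 1) / suc (sum as)) * (c /! sum as)) Ω≡ ⟩
    ((+ 1) / suc (sum as)) * (sumBelow h m /! sum as)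
  ≡⟨ cong (((+ 1) / suc (sum as)) *_) (sym (sumℚ-/! g h m (sum as) terms)) ⟩
    ((+ 1) / suc (sum as)) * sumℚ (map g (upTo m))
  ∎
  where open ≡-Reasoning

theorem2 : (ps : List (ℕ × ℕ)) → 1 ≤ length ps
    → All (λ p → 1 ≤ proj₁ p × 1 ≤ proj₂ p) ps
    → (Ω' (flat ps) ≡ ((+ 1) / suc (sum (flat ps))) * sumℚ (map (λ k → Ω' (flat (take k ps) ++ (proj₁ (pairAt ps k) ∸ 1) ∷ []) * Ω' ((proj₂ (pairAt ps k) ∸ 1) ∷ flat (drop (suc k) ps))) (upTo (length ps))))
      × (Ω' (flat ps) ≡ ((+ 1) / suc (sum (flat ps))) * sumℚ (map (λ k → Ω' (decLast (flat (take k ps))) * Ω' (decHead (flat (drop k ps)))) (upTo (suc (length ps)))))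
theorem2 ps nonempty ps-pos =
  Ω'-as-sum (flat ps) _ (upCut peakSplit ps) (length ps) (Ω-up-cuts ps nonempty ps-pos) (λ k k<n → up-cut-term ps k ps-pos k<n) ,
  Ω'-as-sum (flat ps) _ (downCut peakSplit ps) (suc (length ps)) (Ω-down-cuts ps ps-pos) (λ k _ → down-cut-term ps k ps-pos)
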